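{- Let $G$ be a finite graph that is chordal and diamond-free (i.e., $G$ has no induced subgraph isomorphic to the diamond $K_4-e$). Then $\dim_{\mathrm{poc}}(G)\le 3$.
   Context: For $x=(x_1,\dots,x_d),y=(y_1,\dots,y_d)\in\mathbb{R}^d$ write $x\prec y$ if $x_i<y_i$ for all $i$. For a finite $S\subseteq\mathbb{R}^d$, $D_S$ is the digraph with vertex set $S$ and arcs $(x,v)$ for all $v,x\in S$ with $v\prec x$. A digraph is a $d$-partial order if it is isomorphic to some $D_S$ with $S\subseteq\mathbb{R}^d$ finite. The competition graph $C(D)$ of a digraph $D$ has the same vertex set, with distinct $x,y$ adjacent iff there is a vertex $z$ with arcs $(x,z)$ and $(y,z)$ in $D$. The partial order competition dimension $\dim_{\mathrm{poc}}(G)$ of a graph $G$ is the smallest nonnegative integer $d$ such that for some nonnegative integer $k$ and some finite $S\subseteq\mathbb{R}^d$, the graph $G$ together with $k$ isolated vertices is (isomorphic to) $C(D_S)$. -}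

module Defs where

open import Data.Nat using (ℕ; zero; suc; _+_; _∸_; _≤_)
open import Data.Fin using (Fin; toℕ; splitAt)
open import Data.Vec using (Vec; lookup)
open import Data.Rational using (ℚ; _<_)
open import Data.Product using (Σ; Σ-syntax; ∃; ∃-syntax; _×_)
open import Data.Sum using (_⊎_; inj₁; inj₂)
open import Data.Empty using (⊥)
open import Relation.Nullary using (¬_; Dec)
open import Relation.Binary.PropositionalEquality using (_≡_; _≢_)

record Graph : Set₁ where
  field
    n      : ℕ
    Adj    : Fin n → Fin n → Set
    sym    : ∀ {x y} → Adj x y → Adj y x
    irrefl : ∀ {x} → ¬ Adj x x
    dec    : ∀ x y → Dec (Adj x y)

open Graph public

Injective : ∀ {A : Set} {m : ℕ} → (Fin m → A) → Set
Injective {m = m} f = ∀ (i j : Fin m) → f i ≡ f j → i ≡ j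

CycAdj : (L : ℕ) → Fin L → Fin L → Set
CycAdj L i j =
  (suc (toℕ i) ≡ toℕ j) ⊎ (suc (toℕ j) ≡ toℕ i)
  ⊎ ((toℕ i ≡ 0) × (toℕ j ≡ L ∸ 1)) ⊎ ((toℕ j ≡ 0) × (toℕ i ≡ L ∸ 1))

IsCycle : (G : Graph) (L : ℕ) → (Fin L → Fin (n G)) → Set
IsCycle G L c = Injective c × (∀ i j → CycAdj L i j → Adj G (c i) (c j))

Chordal : Graph → Set
Chordal G = ∀ (L : ℕ) → 4 ≤ L → (c : Fin L → Fin (n G)) → IsCycle G L c →
  Σ[ i ∈ Fin L ] Σ[ j ∈ Fin L ] (i ≢ j × ¬ CycAdj L i j × Adj G (c i) (c j))

DiamondAdj : Fin 4 → Fin 4 → Set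
DiamondAdj i j = i ≢ j × ¬ ((toℕ i ≡ 2 × toℕ j ≡ 3) ⊎ (toℕ i ≡ 3 × toℕ j ≡ 2))

HasInducedDiamond : Graph → Set
HasInducedDiamond G = Σ[ f ∈ (Fin 4 → Fin (n G)) ]
  (Injective f × (∀ i j → i ≢ j → (Adj G (f i) (f j) → DiamondAdj i j)
                                  × (DiamondAdj i j → Adj G (f i) (f j))))

DiamondFree : Graph → Set
DiamondFree G = ¬ HasInducedDiamond G

Point : ℕ → Set
Point d = Vec ℚ d

_≺_ : ∀ {d} → Point d → Point d → Set
_≺_ {d} x y = ∀ (i : Fin d) → lookup x i < lookup y i

PlusIsolatedAdj : (G : Graph) (k : ℕ) → Fin (n G + k) → Fin (n G + k) → Set
PlusIsolatedAdj G k x y with splitAt (n G) x | splitAt (n G) y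
... | inj₁ a | inj₁ b = Adj G a b
... | _      | _      = ⊥

-- Adjacency in the competition graph C(D_S) of the d-partial order D_S,
-- S = image of p : arcs (x , v) iff v ≺ x, and x, y compete iff they have
-- a common out-neighbour z.
CompAdj : ∀ {d m} → (Fin m → Point d) → Fin m → Fin m → Set
CompAdj {m = m} p x y = Σ[ z ∈ Fin m ] ((p z ≺ p x) × (p z ≺ p y))

-- G together with k isolated vertices is isomorphic to C(D_S) for some
-- finite S ⊆ ℚ^d with |S| = n G + k (the injective labelling p is the isomorphism).
PocRepresentation : Graph → ℕ → Set
PocRepresentation G d =
  Σ[ k ∈ ℕ ] Σ[ p ∈ (Fin (n G + k) → Point d) ]
    (Injective p ×
     (∀ x y → x ≢ y → (PlusIsolatedAdj G k x y → CompAdj p x y)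
                      × (CompAdj p x y → PlusIsolatedAdj G k x y)))

DimPocAtMost : Graph → ℕ → Set
DimPocAtMost G d = Σ[ e ∈ ℕ ] (e ≤ d × PocRepresentation G e)

module Submission where

-- Chordal diamond-free graphs are block graphs: every edge lies in exactly one maximal clique (block).
-- Give each vertex a point and add one extra point per block, lying below exactly the members of the
-- block; then two points have a common point below them iff they are vertices sharing a block, i.e.
-- adjacent vertices, so G plus one isolated vertex per block is C(D_S).
-- The points are built along a perfect elimination ordering. In a chordal diamond-free graph every cycle
-- spans a clique (split it along a chord; a vertex on each side of the chord together with its two ends
-- would otherwise form a diamond), so the end of a maximal path is simplicial. A simplicial vertex v is
-- isolated, pendant, or its neighbourhood is one block of G - v, and in each case v can be placed by
-- extending lexicographic keys: three coordinates, each the rank of a key in a strict total order.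

open import Level using (0ℓ)
open import Function.Base using (_∘_; id)
open import Function.Bundles using (Equivalence)
open import Data.Empty using (⊥-elim)
open import Data.Bool as Bool using (Bool; true; false)
import Data.Bool.Properties as 𝔹ₚ
open import Data.Nat as ℕ using (ℕ; zero; suc; _+_; _*_; _∸_; _≤_; _<_; z≤n; s≤s; _≤?_)
import Data.Nat.Properties as ℕₚ
open import Data.Nat.Induction using (<-rec)
open import Data.Nat.Solver using (module +-*-Solver)
open +-*-Solver using (solve; _:+_; _:*_; _:=_; con)
open import Data.Nat.Coprimality using (1-coprimeTo) renaming (sym to coprime-sym)
import Data.Integer as ℤ
import Data.Integer.Properties as ℤₚ
open import Data.Rational as ℚ using (ℚ; mkℚ)
open import Data.Product using (Σ; Σ-syntax; _×_; _,_; proj₁; proj₂)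
open import Data.Product.Relation.Binary.Lex.Strict using (×-Lex; ×-transitive; ×-compare)
open import Data.Product.Relation.Binary.Pointwise.NonDependent using (Pointwise; ≡×≡⇒≡; ≡⇒≡×≡)
open import Data.Sum using (_⊎_; inj₁; inj₂)
open import Data.List using (List; []; _∷_; _++_; [_])
open import Data.List.Relation.Unary.All as All using (All; []; _∷_)
import Data.List.Relation.Unary.All.Properties as AllP
open import Data.Vec using (tabulate; lookup; []; _∷_; there)
open import Data.Vec.Properties using (lookup⇒[]=; []=⇒lookup; lookup∘tabulate)
open import Data.Fin as Fin using (Fin; zero; suc; toℕ; #_; splitAt)
import Data.Fin.Properties as Finₚ
open import Data.Fin.Properties using (toℕ-injective; toℕ<n; toℕ-fromℕ<)
open import Data.Fin.Subset using (Subset; _∈_; _∉_; ∣_∣; _-_; ⁅_⁆; ⊤)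
open import Data.Fin.Subset.Properties
  using (_∈?_; p─q⊆p; x∈p∧x≢y⇒x∈p-y; x∈p⇒∣p-x∣<∣p∣; p⊂q⇒∣p∣<∣q∣; nonempty?; ∈⊤; ∣p∣≤n)
open import Relation.Nullary using (¬_; Dec; yes; no; ¬?)
open import Relation.Nullary.Decidable using (isYes; toWitness; fromWitness; _×-dec_; _⊎-dec_; map′)
open import Relation.Binary.Core using (Rel)
open import Relation.Binary.Definitions using (DecidableEquality; Transitive; Trichotomous; tri<; tri≈; tri>)
open import Relation.Binary.Consequences using (tri⇒irr; tri⇒dec<)
import Relation.Binary.Construct.Flip.EqAndOrd as Flip
open import Relation.Binary.PropositionalEquality
  using (_≡_; _≢_; refl; sym; trans; cong; subst; subst₂; isEquivalence; resp₂; module ≡-Reasoning)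

open import Defs hiding (sym)

module Rank {A : Set} {_⊏_ : Rel A 0ℓ} (⊏-trans : Transitive _⊏_) (⊏-cmp : Trichotomous _≡_ _⊏_)
            {N : ℕ} (key : Fin N → A) where

  _⊏?_ : ∀ x y → Dec (x ⊏ y)
  _⊏?_ = tri⇒dec< ⊏-cmp

  ⊏-irrefl : ∀ {x} → ¬ x ⊏ x
  ⊏-irrefl = tri⇒irr ⊏-cmp refl

  below : A → Subset N
  below x = tabulate (λ e → isYes (key e ⊏? x))

  ∈-below⁺ : ∀ {x e} → key e ⊏ x → e ∈ below x
  ∈-below⁺ {x} {e} e⊏x =
    lookup⇒[]= e _ (trans (lookup∘tabulate _ e) (Equivalence.to 𝔹ₚ.T-≡ (fromWitness {a? = key e ⊏? x} e⊏x)))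

  ∈-below⁻ : ∀ {x e} → e ∈ below x → key e ⊏ x
  ∈-below⁻ {x} {e} e∈ =
    toWitness {a? = key e ⊏? x} (Equivalence.from 𝔹ₚ.T-≡ (trans (sym (lookup∘tabulate _ e)) ([]=⇒lookup e∈)))

  rank : Fin N → ℕ
  rank e = ∣ below (key e) ∣

  rank-mono-< : ∀ a b → key a ⊏ key b → rank a < rank b
  rank-mono-< a b a⊏b = p⊂q⇒∣p∣<∣q∣
    ((λ e∈ → ∈-below⁺ (⊏-trans (∈-below⁻ e∈) a⊏b)) , a , ∈-below⁺ a⊏b , λ a∈ → ⊏-irrefl (∈-below⁻ a∈))

  rank-cancel-< : ∀ a b → rank a < rank b → key a ⊏ key b
  rank-cancel-< a b lt with ⊏-cmp (key a) (key b)
  ... | tri< a⊏b _ _ = a⊏b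
  ... | tri≈ _ a≡b _ = ⊥-elim (ℕₚ.<-irrefl (cong (∣_∣ ∘ below) a≡b) lt)
  ... | tri> _ _ b⊏a = ⊥-elim (ℕₚ.<-asym lt (rank-mono-< b a b⊏a))

  rank-injective : ∀ a b → rank a ≡ rank b → key a ≡ key b
  rank-injective a b eq with ⊏-cmp (key a) (key b)
  ... | tri< a⊏b _ _ = ⊥-elim (ℕₚ.<-irrefl eq (rank-mono-< a b a⊏b))
  ... | tri≈ _ a≡b _ = a≡b
  ... | tri> _ _ b⊏a = ⊥-elim (ℕₚ.<-irrefl (sym eq) (rank-mono-< b a b⊏a))

ℕ→ℚ : ℕ → ℚ
ℕ→ℚ k = mkℚ (ℤ.+ k) 0 (coprime-sym (1-coprimeTo k))

ℕ→ℚ-mono-< : ∀ {a b} → a < b → ℕ→ℚ a ℚ.< ℕ→ℚ b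
ℕ→ℚ-mono-< {a} {b} a<b =
  ℚ.*<* (subst₂ ℤ._<_ (sym (ℤₚ.*-identityʳ (ℤ.+ a))) (sym (ℤₚ.*-identityʳ (ℤ.+ b))) (ℤ.+<+ a<b))

ℕ→ℚ-cancel-< : ∀ {a b} → ℕ→ℚ a ℚ.< ℕ→ℚ b → a < b
ℕ→ℚ-cancel-< {a} {b} (ℚ.*<* lt) with subst₂ ℤ._<_ (ℤₚ.*-identityʳ (ℤ.+ a)) (ℤₚ.*-identityʳ (ℤ.+ b)) lt
... | ℤ.+<+ a<b = a<b

ℕ→ℚ-injective : ∀ {a b} → ℕ→ℚ a ≡ ℕ→ℚ b → a ≡ b
ℕ→ℚ-injective eq = cong ℤ.∣_∣ (cong ℚ.numerator eq)

≡×≡-compare⇒≡-compare : ∀ {A B : Set} {_⊏_ : Rel (A × B) 0ℓ} →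
  Trichotomous (Pointwise _≡_ _≡_) _⊏_ → Trichotomous _≡_ _⊏_
≡×≡-compare⇒≡-compare cmp x y with cmp x y
... | tri< a ¬b ¬c = tri< a (¬b ∘ ≡⇒≡×≡) ¬c
... | tri≈ ¬a b ¬c = tri≈ ¬a (≡×≡⇒≡ b) ¬c
... | tri> ¬a ¬b c = tri> ¬a (¬b ∘ ≡⇒≡×≡) c

Entry : Set
Entry = ℕ × ℕ

_<ₑ_ : Rel Entry 0ℓ
_<ₑ_ = ×-Lex _≡_ _<_ _<_

<ₑ-trans : Transitive _<ₑ_
<ₑ-trans = ×-transitive {_<₁_ = _<_} {_<₂_ = _<_} isEquivalence ℕₚ.<-resp₂-≡ ℕₚ.<-trans ℕₚ.<-trans

<ₑ-cmp : Trichotomous _≡_ _<ₑ_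
<ₑ-cmp = ≡×≡-compare⇒≡-compare (×-compare sym ℕₚ.<-cmp ℕₚ.<-cmp)

<ₑ-irrefl : ∀ {e} → ¬ e <ₑ e
<ₑ-irrefl = tri⇒irr <ₑ-cmp refl

<ₑ-asym : ∀ {e e′} → e <ₑ e′ → ¬ e′ <ₑ e
<ₑ-asym p q = <ₑ-irrefl (<ₑ-trans p q)

infix 4 _◁_ _⊴_

-- Lexicographic order in which every list lies above all of its proper extensions.
data _◁_ : Rel (List Entry) 0ℓ where
  here  : ∀ {x y xs ys} → x <ₑ y → (x ∷ xs) ◁ (y ∷ ys)
  there : ∀ {x xs ys} → xs ◁ ys → (x ∷ xs) ◁ (x ∷ ys)
  end   : ∀ {x xs} → (x ∷ xs) ◁ []

_⊴_ : Rel (List Entry) 0ℓ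
xs ⊴ ys = xs ◁ ys ⊎ xs ≡ ys

◁-irrefl : ∀ {xs} → ¬ xs ◁ xs
◁-irrefl (here p)  = <ₑ-irrefl p
◁-irrefl (there p) = ◁-irrefl p

◁-trans : Transitive _◁_
◁-trans (here p)  (here q)  = here (<ₑ-trans p q)
◁-trans (here p)  (there q) = here p
◁-trans (there p) (here q)  = here q
◁-trans (there p) (there q) = there (◁-trans p q)
◁-trans (here p)  end       = end
◁-trans (there p) end       = end

◁-asym : ∀ {xs ys} → xs ◁ ys → ¬ ys ◁ xs
◁-asym p q = ◁-irrefl (◁-trans p q)

◁-cmp : Trichotomous _≡_ _◁_
◁-cmp []       []       = tri≈ (λ ()) refl (λ ())
◁-cmp []       (y ∷ ys) = tri> (λ ()) (λ ()) end
◁-cmp (x ∷ xs) []       = tri< end (λ ()) (λ ())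
◁-cmp (x ∷ xs) (y ∷ ys) with <ₑ-cmp x y
... | tri< p _ _ = tri< (here p) (λ { refl → <ₑ-irrefl p }) λ { (here q) → <ₑ-asym p q ; (there q) → <ₑ-irrefl p }
... | tri> _ _ p = tri> (λ { (here q) → <ₑ-asym p q ; (there q) → <ₑ-irrefl p }) (λ { refl → <ₑ-irrefl p }) (here p)
... | tri≈ _ refl _ with ◁-cmp xs ys
...   | tri< p _ _ = tri< (there p) (λ { refl → ◁-irrefl p }) λ { (here q) → <ₑ-irrefl q ; (there q) → ◁-asym p q }
...   | tri≈ _ refl _ = tri≈ ◁-irrefl refl ◁-irrefl
...   | tri> _ _ p = tri> (λ { (here q) → <ₑ-irrefl q ; (there q) → ◁-asym p q }) (λ { refl → ◁-irrefl p }) (there p)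

extension-◁ : ∀ p x xs → (p ++ x ∷ xs) ◁ p
extension-◁ []      x xs = end
extension-◁ (a ∷ p) x xs = there (extension-◁ p x xs)

◁-prefix : ∀ p {xs ys} → xs ◁ ys → (p ++ xs) ◁ (p ++ ys)
◁-prefix []      lt = lt
◁-prefix (a ∷ p) lt = there (◁-prefix p lt)

between-extension : ∀ p e₀ xs → (p ++ [ e₀ ]) ⊴ xs → xs ⊴ p →
  xs ≡ p ⊎ Σ Entry λ e → Σ (List Entry) λ q → xs ≡ p ++ e ∷ q × ¬ e <ₑ e₀
between-extension [] e₀ [] _ _ = inj₁ refl
between-extension [] e₀ (y ∷ ys) (inj₁ (here p)) _ = inj₂ (y , ys , refl , <ₑ-asym p)
between-extension [] e₀ (y ∷ ys) (inj₂ refl) _ = inj₂ (e₀ , [] , refl , <ₑ-irrefl)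
between-extension (a ∷ p) e₀ xs _ (inj₂ refl) = inj₁ refl
between-extension (a ∷ p) e₀ (b ∷ xs) (inj₁ (here q)) (inj₁ (here r)) = ⊥-elim (<ₑ-asym q r)
between-extension (a ∷ p) e₀ (b ∷ xs) (inj₁ (there q)) (inj₁ (here r)) = ⊥-elim (<ₑ-irrefl r)
between-extension (a ∷ p) e₀ (b ∷ xs) (inj₂ refl) (inj₁ (here r)) = ⊥-elim (<ₑ-irrefl r)
between-extension (a ∷ p) e₀ (a ∷ xs) (inj₁ (here q)) (inj₁ (there r)) = ⊥-elim (<ₑ-irrefl q)
between-extension (a ∷ p) e₀ (a ∷ xs) (inj₂ refl) (inj₁ (there r)) = inj₂ (e₀ , [] , refl , <ₑ-irrefl)
between-extension (a ∷ p) e₀ (a ∷ xs) (inj₁ (there q)) (inj₁ (there r))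
  with between-extension p e₀ xs (inj₁ q) (inj₁ r)
... | inj₁ refl = inj₁ refl
... | inj₂ (e , q′ , refl , e≮e₀) = inj₂ (e , q′ , refl , e≮e₀)

Key : Set
Key = List Entry × Bool

_<ₖ_ : Rel Key 0ℓ
_<ₖ_ = ×-Lex _≡_ _◁_ Bool._<_

<ₖ-trans : Transitive _<ₖ_
<ₖ-trans = ×-transitive {_<₁_ = _◁_} {_<₂_ = Bool._<_} isEquivalence (resp₂ _◁_) ◁-trans 𝔹ₚ.<-trans

<ₖ-cmp : Trichotomous _≡_ _<ₖ_
<ₖ-cmp = ≡×≡-compare⇒≡-compare (×-compare sym ◁-cmp 𝔹ₚ.<-cmp)

<ₖ-irrefl : ∀ {k} → ¬ k <ₖ k
<ₖ-irrefl = tri⇒irr <ₖ-cmp refl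

<ₖ⇒⊴ : ∀ {p q} → (p , false) <ₖ (q , true) → p ⊴ q
<ₖ⇒⊴ (inj₁ lt)       = inj₁ lt
<ₖ⇒⊴ (inj₂ (refl , _)) = inj₂ refl

<ₖ⇒◁ : ∀ {p q b} → (p , b) <ₖ (q , b) → p ◁ q
<ₖ⇒◁ (inj₁ lt)        = lt
<ₖ⇒◁ (inj₂ (_ , b<b)) = ⊥-elim (𝔹ₚ.<-irrefl refl b<b)

skip : ℕ → ℕ → ℕ → ℕ
skip zero    s zero    = zero
skip zero    s (suc k) = s + suc k
skip (suc i) s zero    = zero
skip (suc i) s (suc k) = suc (skip i s k)

skip-zero : ∀ i s → skip i s 0 ≡ 0
skip-zero zero    s = refl
skip-zero (suc i) s = refl

skip-≤ : ∀ i s {k} → k ≤ i → skip i s k ≡ k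
skip-≤ zero    s z≤n       = refl
skip-≤ (suc i) s z≤n       = refl
skip-≤ (suc i) s (s≤s k≤i) = cong suc (skip-≤ i s k≤i)

skip-> : ∀ i s {k} → i < k → skip i s k ≡ s + k
skip-> zero    s {suc k} _         = refl
skip-> (suc i) s {suc k} (s≤s i<k) = trans (cong suc (skip-> i s i<k)) (sym (ℕₚ.+-suc s k))

skip-suc : ∀ i s k → k ≢ i → skip i s (suc k) ≡ suc (skip i s k)
skip-suc zero    s zero    0≢0 = ⊥-elim (0≢0 refl)
skip-suc zero    s (suc k) _   = ℕₚ.+-suc s (suc k)
skip-suc (suc i) s zero    _   = cong suc (skip-zero i s)
skip-suc (suc i) s (suc k) k≢i = cong suc (skip-suc i s k (k≢i ∘ cong suc))

skip-separates : ∀ i s {a b} → a ≤ i → i < b → skip i s a ≢ skip i s b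
skip-separates i s {a} {b} a≤i i<b eq = ℕₚ.<⇒≱ (ℕₚ.<-≤-trans i<b b≤a) a≤i
  where
  b≤a : b ≤ a
  b≤a = ℕₚ.≤-trans (ℕₚ.m≤n+m b s) (ℕₚ.≤-reflexive (trans (sym (skip-> i s i<b)) (trans (sym eq) (skip-≤ i s a≤i))))

skip-injective : ∀ i s {a b} → skip i s a ≡ skip i s b → a ≡ b
skip-injective i s {a} {b} eq with a ≤? i | b ≤? i
... | yes a≤i | yes b≤i = trans (sym (skip-≤ i s a≤i)) (trans eq (skip-≤ i s b≤i))
... | no a≰i  | no b≰i  =
  ℕₚ.+-cancelˡ-≡ s a b (trans (sym (skip-> i s (ℕₚ.≰⇒> a≰i))) (trans eq (skip-> i s (ℕₚ.≰⇒> b≰i))))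
... | yes a≤i | no b≰i  = ⊥-elim (skip-separates i s a≤i (ℕₚ.≰⇒> b≰i) eq)
... | no a≰i  | yes b≤i = ⊥-elim (skip-separates i s b≤i (ℕₚ.≰⇒> a≰i) (sym eq))

record Keys : Set where
  constructor keys
  field
    x : Key
    y : ℕ
    z : Key

infix 4 _⋖_

_⋖_ : Keys → Keys → Set
p ⋖ q = Keys.x p <ₖ Keys.x q × Keys.y q < Keys.y p × Keys.z q <ₖ Keys.z p

⋖-trans : ∀ {p q r} → p ⋖ q → q ⋖ r → p ⋖ r
⋖-trans (x₁ , y₁ , z₁) (x₂ , y₂ , z₂) = <ₖ-trans x₁ x₂ , ℕₚ.<-trans y₂ y₁ , <ₖ-trans z₂ z₁

⋖-irrefl : ∀ {p} → ¬ p ⋖ p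
⋖-irrefl (x , _ , _) = <ₖ-irrefl x

-- A block whose anchor has position p lies below a vertex at position q and level ℓ iff
-- p ++ [ (s , 0) ] ⊴ q ⊴ p and ℓ < 4 s + 2. An isolated or pendant new vertex gets level 4 (h + 1),
-- too high for every existing block; a vertex joining block s gets level 4 s + 1, which keeps it out
-- of every block with a smaller stamp, while its position keeps it out of those with a larger one.
vertexKeys : List Entry → ℕ → Keys
vertexKeys p ℓ = keys (p , true) ℓ (p , false)

blockKeys : List Entry → ℕ → Keys
blockKeys p s = keys (p ++ [ (s , 0) ] , false) (4 * s + 2) (p , true)

Bounded : ℕ → Entry → Set
Bounded m (a , b) = a ≤ m × b ≤ m

bounded-suc : ∀ {m xs} → All (Bounded m) xs → All (Bounded (suc m)) xs
bounded-suc = All.map λ (a≤m , b≤m) → ℕₚ.m≤n⇒m≤1+n a≤m , ℕₚ.m≤n⇒m≤1+n b≤m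

bounded⇒first< : ∀ {m xs} → All (Bounded m) xs → All (λ e → proj₁ e < suc m) xs
bounded⇒first< = All.map λ (a≤m , _) → s≤s a≤m

vertex-not-⋖-vertex : ∀ p ℓ q ℓ′ → ¬ vertexKeys p ℓ ⋖ vertexKeys q ℓ′
vertex-not-⋖-vertex p ℓ q ℓ′ (x , _ , z) = ◁-asym (<ₖ⇒◁ x) (<ₖ⇒◁ z)

vertex-not-⋖-block : ∀ p ℓ q s → ¬ vertexKeys p ℓ ⋖ blockKeys q s
vertex-not-⋖-block p ℓ q s (inj₁ x , _ , inj₁ z) = ◁-irrefl (◁-trans x (◁-trans (extension-◁ q (s , 0) []) z))
vertex-not-⋖-block p ℓ q s (inj₂ (_ , ()) , _ , _)
vertex-not-⋖-block p ℓ q s (_ , _ , inj₂ (_ , ()))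

⋖-anchor : ∀ p s ℓ → ℓ < 4 * s + 2 → blockKeys p s ⋖ vertexKeys p ℓ
⋖-anchor p s ℓ ℓ< = inj₁ (extension-◁ p (s , 0) []) , ℓ< , inj₂ (refl , Bool.f<t)

⋖-child : ∀ p s t ℓ → 0 < t → ℓ < 4 * s + 2 → blockKeys p s ⋖ vertexKeys (p ++ [ (s , t) ]) ℓ
⋖-child p s t ℓ 0<t ℓ< = inj₁ (◁-prefix p (here (inj₂ (refl , 0<t)))) , ℓ< , inj₁ (extension-◁ p (s , t) [])

4*-mono : ∀ {a b} c → a ≤ b → 4 * a + c ≤ 4 * b + c
4*-mono c a≤b = ℕₚ.+-monoˡ-≤ c (ℕₚ.*-monoʳ-≤ 4 a≤b)

4*suc : ∀ m c → 4 * suc m + c ≡ 4 * m + (4 + c)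
4*suc m c = solve 2 (λ m c → con 4 :* (con 1 :+ m) :+ c := con 4 :* m :+ (con 4 :+ c)) refl m c

high-level-not-⋖ : ∀ {m} p q t → t ≤ m → ¬ blockKeys p t ⋖ vertexKeys q (4 * suc m)
high-level-not-⋖ {m} p q t t≤m (_ , ℓ< , _) = ℕₚ.<⇒≱ ℓ< (begin
  4 * t + 2       ≤⟨ 4*-mono 2 t≤m ⟩
  4 * m + 2       ≤⟨ ℕₚ.+-monoʳ-≤ (4 * m) (ℕₚ.m≤m+n 2 2) ⟩
  4 * m + (4 + 0) ≡⟨ 4*suc m 0 ⟨
  4 * suc m + 0   ≡⟨ ℕₚ.+-identityʳ (4 * suc m) ⟩
  4 * suc m       ∎)
  where open ℕₚ.≤-Reasoning

fresh-entry-unbounded : ∀ {m} p s → ¬ All (Bounded m) (p ++ [ (s , suc m) ])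
fresh-entry-unbounded p s bounded with AllP.++⁻ʳ p bounded
... | (_ , sm≤m) ∷ [] = ℕₚ.<-irrefl refl sm≤m

fresh-block-member-is-anchor : ∀ {m} p q ℓ → All (Bounded m) q → blockKeys p (suc m) ⋖ vertexKeys q ℓ → q ≡ p
fresh-block-member-is-anchor {m} p q ℓ q-bounded (x , _ , z) with between-extension p (suc m , 0) q (<ₖ⇒⊴ x) (<ₖ⇒⊴ z)
... | inj₁ q≡p = q≡p
... | inj₂ (e , _ , refl , e≮) with AllP.++⁻ʳ p q-bounded
...   | (e₁≤m , _) ∷ _ = ⊥-elim (e≮ (inj₁ (s≤s e₁≤m)))

new-member-in-one-block : ∀ {m} p s p′ s′ → All (λ e → proj₁ e < s) p → All (Bounded m) p′ → s ≢ s′ →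
  ¬ blockKeys p′ s′ ⋖ vertexKeys (p ++ [ (s , suc m) ]) (4 * s + 1)
new-member-in-one-block {m} p s p′ s′ p<s p′-bounded s≢s′ (x , ℓ< , z)
  with between-extension p′ (s′ , 0) _ (<ₖ⇒⊴ x) (<ₖ⇒⊴ z)
... | inj₁ eq = fresh-entry-unbounded p s (subst (All (Bounded m)) (sym eq) p′-bounded)
... | inj₂ (e , q , eq , e≮) =
  e≮ (inj₁ (ℕₚ.≤-<-trans (head-≤ (AllP.++⁻ʳ p′ (subst (All (λ e → proj₁ e ≤ s)) eq entries≤s))) s<s′))
  where
  s<s′ : s < s′
  s<s′ = ℕₚ.≤∧≢⇒< (ℕₚ.≮⇒≥ λ s′<s → ℕₚ.<⇒≱ ℓ< (begin
    4 * s′ + 2       ≤⟨ ℕₚ.+-monoʳ-≤ (4 * s′) (ℕₚ.m≤m+n 2 3) ⟩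
    4 * s′ + (4 + 1) ≡⟨ 4*suc s′ 1 ⟨
    4 * suc s′ + 1   ≤⟨ 4*-mono 1 s′<s ⟩
    4 * s + 1        ∎)) s≢s′
    where open ℕₚ.≤-Reasoning
  entries≤s : All (λ e → proj₁ e ≤ s) (p ++ [ (s , suc m) ])
  entries≤s = AllP.++⁺ (All.map ℕₚ.<⇒≤ p<s) (ℕₚ.≤-refl ∷ [])
  head-≤ : ∀ {e q} → All (λ e → proj₁ e ≤ s) (e ∷ q) → proj₁ e ≤ s
  head-≤ (e≤s ∷ _) = e≤s

x∉p-x : ∀ {k} (p : Subset k) x → x ∉ p - x
x∉p-x (_ ∷ p) zero    ()
x∉p-x (_ ∷ p) (suc x) (there x∈p-x) = x∉p-x p x x∈p-x

Hits : ∀ {A : Set} → (ℕ → A) → ℕ → A → Set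
Hits f M a = Σ ℕ λ k → k < M × f k ≡ a

hits? : ∀ {A : Set} → DecidableEquality A → ∀ (f : ℕ → A) M a → Dec (Hits f M a)
hits? _≟_ f M a = map′ (λ (k , e) → toℕ k , toℕ<n k , e)
                       (λ (k , k<M , e) → Fin.fromℕ< k<M , trans (cong f (toℕ-fromℕ< k<M)) e)
                       (Finₚ.any? (λ k → f (toℕ k) ≟ a))

module _ (G : Graph) where

  open Graph G using () renaming (Adj to infix 4 _~_; sym to ~-sym; irrefl to ~-irrefl; dec to _~?_)

  private
    V : Set
    V = Fin (n G)

  ~⇒≢ : ∀ {x y} → x ~ y → x ≢ y
  ~⇒≢ x~y refl = ~-irrefl x~y

  diamond-free⇒adjacent : DiamondFree G → ∀ {a b c d} → c ≢ d →
    a ~ b → a ~ c → a ~ d → b ~ c → b ~ d → c ~ d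
  diamond-free⇒adjacent diamond-free {a} {b} {c} {d} c≢d ab ac ad bc bd with c ~? d
  ... | yes cd = cd
  ... | no ¬cd = ⊥-elim (diamond-free (f , f-injective , f-induces))
    where
    f : Fin 4 → V
    f = lookup (a ∷ b ∷ c ∷ d ∷ [])

    Missing : Fin 4 → Fin 4 → Set
    Missing i j = (toℕ i ≡ 2 × toℕ j ≡ 3) ⊎ (toℕ i ≡ 3 × toℕ j ≡ 2)

    missing? : ∀ i j → Dec (Missing i j)
    missing? i j = (toℕ i ℕ.≟ 2 ×-dec toℕ j ℕ.≟ 3) ⊎-dec (toℕ i ℕ.≟ 3 ×-dec toℕ j ℕ.≟ 2)

    missing⇒cd : ∀ {i j} → Missing i j → (f i ≡ c × f j ≡ d) ⊎ (f i ≡ d × f j ≡ c)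
    missing⇒cd {i} {j} (inj₁ (i≡2 , j≡3))
      rewrite toℕ-injective {i = i} {j = # 2} i≡2 | toℕ-injective {i = j} {j = # 3} j≡3 = inj₁ (refl , refl)
    missing⇒cd {i} {j} (inj₂ (i≡3 , j≡2))
      rewrite toℕ-injective {i = i} {j = # 3} i≡3 | toℕ-injective {i = j} {j = # 2} j≡2 = inj₂ (refl , refl)

    edge : ∀ i j → i ≢ j → ¬ Missing i j → f i ~ f j
    edge zero                   (suc zero)             _ _ = ab
    edge zero                   (suc (suc zero))       _ _ = ac
    edge zero                   (suc (suc (suc zero))) _ _ = ad
    edge (suc zero)             (suc (suc zero))       _ _ = bc
    edge (suc zero)             (suc (suc (suc zero))) _ _ = bd
    edge (suc zero)             zero                   _ _ = ~-sym ab
    edge (suc (suc zero))       zero                   _ _ = ~-sym ac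
    edge (suc (suc (suc zero))) zero                   _ _ = ~-sym ad
    edge (suc (suc zero))       (suc zero)             _ _ = ~-sym bc
    edge (suc (suc (suc zero))) (suc zero)             _ _ = ~-sym bd
    edge (suc (suc zero))       (suc (suc (suc zero))) _ ¬m = ⊥-elim (¬m (inj₁ (refl , refl)))
    edge (suc (suc (suc zero))) (suc (suc zero))       _ ¬m = ⊥-elim (¬m (inj₂ (refl , refl)))
    edge zero                   zero                   i≢i _ = ⊥-elim (i≢i refl)
    edge (suc zero)             (suc zero)             i≢i _ = ⊥-elim (i≢i refl)
    edge (suc (suc zero))       (suc (suc zero))       i≢i _ = ⊥-elim (i≢i refl)
    edge (suc (suc (suc zero))) (suc (suc (suc zero))) i≢i _ = ⊥-elim (i≢i refl)

    f-injective : Injective f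
    f-injective i j fi≡fj with i Fin.≟ j | missing? i j
    ... | yes i≡j | _ = i≡j
    ... | no i≢j | no ¬m = ⊥-elim (~⇒≢ (edge i j i≢j ¬m) fi≡fj)
    ... | no _ | yes m with missing⇒cd m
    ...   | inj₁ (fi≡c , fj≡d) = ⊥-elim (c≢d (trans (sym fi≡c) (trans fi≡fj fj≡d)))
    ...   | inj₂ (fi≡d , fj≡c) = ⊥-elim (c≢d (trans (sym fj≡c) (trans (sym fi≡fj) fi≡d)))

    f-induces : ∀ i j → i ≢ j → (f i ~ f j → DiamondAdj i j) × (DiamondAdj i j → f i ~ f j)
    f-induces i j i≢j with missing? i j
    ... | no ¬m = (λ _ → i≢j , ¬m) , λ _ → edge i j i≢j ¬m
    ... | yes m = (λ fi~fj → ⊥-elim (¬cd (non-edge m fi~fj))) , λ (_ , ¬m) → ⊥-elim (¬m m)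
      where
      non-edge : Missing i j → f i ~ f j → c ~ d
      non-edge m fi~fj with missing⇒cd m
      ... | inj₁ (fi≡c , fj≡d) = subst₂ _~_ fi≡c fj≡d fi~fj
      ... | inj₂ (fi≡d , fj≡c) = ~-sym (subst₂ _~_ fi≡d fj≡c fi~fj)

  InjectiveOn : (ℕ → V) → ℕ → Set
  InjectiveOn f L = ∀ a b → a < L → b < L → f a ≡ f b → a ≡ b

  IsWalk : (ℕ → V) → ℕ → Set
  IsWalk f L = ∀ a → suc a < L → f a ~ f (suc a)

  IsClique : (ℕ → V) → ℕ → Set
  IsClique f L = ∀ a b → a < L → b < L → a ≢ b → f a ~ f b

  record Cycle (L : ℕ) (f : ℕ → V) : Set where
    field
      injective : InjectiveOn f L
      walk      : IsWalk f L
      closing   : f 0 ~ f (L ∸ 1)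

  ShorterCyclesAreCliques : ℕ → Set
  ShorterCyclesAreCliques L = ∀ {M g} → M < L → 3 ≤ M → Cycle M g → IsClique g M

  clique-reindex : ∀ {f} {σ : ℕ → ℕ} {M a b} → IsClique (f ∘ σ) M → Hits σ M a → Hits σ M b → a ≢ b →
                   f a ~ f b
  clique-reindex {σ = σ} clique (k , k<M , refl) (l , l<M , refl) a≢b = clique k l k<M l<M (a≢b ∘ cong σ)

  triangle-clique : ∀ {f} → Cycle 3 f → IsClique f 3
  triangle-clique c 0 1 _ _ _ = Cycle.walk c 0 (s≤s (s≤s z≤n))
  triangle-clique c 1 2 _ _ _ = Cycle.walk c 1 ℕₚ.≤-refl
  triangle-clique c 0 2 _ _ _ = Cycle.closing c
  triangle-clique c 1 0 _ _ _ = ~-sym (Cycle.walk c 0 (s≤s (s≤s z≤n)))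
  triangle-clique c 2 1 _ _ _ = ~-sym (Cycle.walk c 1 ℕₚ.≤-refl)
  triangle-clique c 2 0 _ _ _ = ~-sym (Cycle.closing c)
  triangle-clique c 0 0 _ _ 0≢0 = ⊥-elim (0≢0 refl)
  triangle-clique c 1 1 _ _ 1≢1 = ⊥-elim (1≢1 refl)
  triangle-clique c 2 2 _ _ 2≢2 = ⊥-elim (2≢2 refl)
  triangle-clique c (suc (suc (suc a))) b (s≤s (s≤s (s≤s ()))) _ _
  triangle-clique c a (suc (suc (suc b))) _ (s≤s (s≤s (s≤s ()))) _

  -- A cycle of length L = 3 + d + i + r with a chord from i to j = 2 + d + i (so that the lengths
  -- reduce definitionally); it splits into the inner cycle i, …, j and the outer cycle 0, …, i, j, …, L-1.
  module ChordSplit (diamond-free : DiamondFree G) {f : ℕ → V} (i d r : ℕ)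
                    (cycle : Cycle (3 + d + i + r) f) (chord : f i ~ f (2 + d + i)) where

    open Cycle cycle

    inner : ℕ → ℕ
    inner k = k + i

    inner<L : ∀ {k} → k < 3 + d → inner k < 3 + d + i + r
    inner<L k<3+d = ℕₚ.<-≤-trans (ℕₚ.+-monoˡ-< i k<3+d) (ℕₚ.m≤m+n (3 + d + i) r)

    inner-cycle : Cycle (3 + d) (f ∘ inner)
    inner-cycle = record
      { injective = λ a b a< b< eq → ℕₚ.+-cancelʳ-≡ i a b (injective _ _ (inner<L a<) (inner<L b<) eq)
      ; walk      = λ a sa< → walk (a + i) (inner<L sa<)
      ; closing   = chord
      }

    inner-hits : ∀ {a} → i ≤ a → a ≤ 2 + d + i → Hits inner (3 + d) a
    inner-hits {a} i≤a a≤j =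
      a ∸ i , s≤s (subst (a ∸ i ≤_) (ℕₚ.m+n∸n≡m (2 + d) i) (ℕₚ.∸-monoˡ-≤ i a≤j)) , ℕₚ.m∸n+n≡m i≤a

    outer : ℕ → ℕ
    outer = skip i (suc d)

    length-split : suc d + (2 + i + r) ≡ 3 + d + i + r
    length-split = solve 3 (λ d i r → (con 1 :+ d) :+ (con 2 :+ i :+ r) := con 3 :+ d :+ i :+ r) refl d i r

    outer<L : ∀ {k} → k < 2 + i + r → outer k < 3 + d + i + r
    outer<L {k} k<M with k ≤? i
    ... | yes k≤i = subst (_< 3 + d + i + r) (sym (skip-≤ i (suc d) k≤i)) (ℕₚ.≤-<-trans k≤i (inner<L {0} (s≤s z≤n)))
    ... | no k≰i  = subst₂ _<_ (sym (skip-> i (suc d) (ℕₚ.≰⇒> k≰i))) length-split (ℕₚ.+-monoʳ-< (suc d) k<M)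

    outer-cycle : Cycle (2 + i + r) (f ∘ outer)
    outer-cycle = record
      { injective = λ a b a< b< eq → skip-injective i (suc d) (injective _ _ (outer<L a<) (outer<L b<) eq)
      ; walk      = outer-walk
      ; closing   = subst₂ _~_ (cong f (sym (skip-zero i (suc d)))) (cong f (sym last≡)) closing
      }
      where
      outer-walk : IsWalk (f ∘ outer) (2 + i + r)
      outer-walk k sk< with k ℕ.≟ i
      ... | yes refl = subst₂ _~_ (cong f (sym (skip-≤ i (suc d) ℕₚ.≤-refl))) (cong f (sym across)) chord
        where
        across : skip i (suc d) (suc i) ≡ 2 + d + i
        across = trans (skip-> i (suc d) (ℕₚ.n<1+n i)) (cong suc (ℕₚ.+-suc d i))
      ... | no k≢i = subst (λ x → f (outer k) ~ f x) (sym (skip-suc i (suc d) k k≢i))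
                       (walk (outer k) (subst (_< 3 + d + i + r) (skip-suc i (suc d) k k≢i) (outer<L sk<)))
      last≡ : outer (suc (i + r)) ≡ 2 + d + i + r
      last≡ = trans (skip-> i (suc d) (s≤s (ℕₚ.m≤m+n i r)))
                    (solve 3 (λ d i r → (con 1 :+ d) :+ (con 1 :+ (i :+ r)) := con 2 :+ d :+ i :+ r) refl d i r)

    outer-hits : ∀ {a} → a < 3 + d + i + r → a ≤ i ⊎ 2 + d + i ≤ a → Hits outer (2 + i + r) a
    outer-hits {a} a<L (inj₁ a≤i) = a , s≤s (ℕₚ.m≤n⇒m≤1+n (ℕₚ.≤-trans a≤i (ℕₚ.m≤m+n i r))) , skip-≤ i (suc d) a≤i
    outer-hits {a} a<L (inj₂ j≤a) = a ∸ suc d , k<M , trans (skip-> i (suc d) i<k) (ℕₚ.m+[n∸m]≡n sd≤a)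
      where
      sd≤a : suc d ≤ a
      sd≤a = ℕₚ.≤-trans (s≤s (ℕₚ.≤-trans (ℕₚ.m≤m+n d i) (ℕₚ.n≤1+n (d + i)))) j≤a
      i<k : i < a ∸ suc d
      i<k = ℕₚ.m+n≤o⇒m≤o∸n (suc i)
              (subst (_≤ a) (solve 2 (λ d i → con 2 :+ d :+ i := (con 1 :+ i) :+ (con 1 :+ d)) refl d i) j≤a)
      k<M : a ∸ suc d < 2 + i + r
      k<M = ℕₚ.+-cancelʳ-< (suc d) (a ∸ suc d) (2 + i + r)
              (subst₂ _<_ (sym (ℕₚ.m∸n+n≡m sd≤a)) (trans (sym length-split) (ℕₚ.+-comm (suc d) (2 + i + r))) a<L)

    chord-clique : ShorterCyclesAreCliques (3 + d + i + r) → 1 ≤ i + r → IsClique f (3 + d + i + r)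
    chord-clique smaller 1≤i+r = clique
      where
      inner-clique : IsClique (f ∘ inner) (3 + d)
      inner-clique = smaller (subst (3 + d <_) (sym (ℕₚ.+-assoc (3 + d) i r)) (ℕₚ.m<m+n (3 + d) 1≤i+r))
                             (s≤s (s≤s (s≤s z≤n))) inner-cycle

      outer-clique : IsClique (f ∘ outer) (2 + i + r)
      outer-clique = smaller (subst (2 + i + r <_) length-split (ℕₚ.m<n+m (2 + i + r) (s≤s z≤n)))
                             (s≤s (s≤s 1≤i+r)) outer-cycle

      i<L : i < 3 + d + i + r
      i<L = inner<L {0} (s≤s z≤n)

      i≤j : i ≤ 2 + d + i
      i≤j = ℕₚ.m≤n+m i (2 + d)

      j<L : 2 + d + i < 3 + d + i + r
      j<L = inner<L {2 + d} ℕₚ.≤-refl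

      Outside : ℕ → Set
      Outside a = a ≤ i ⊎ 2 + d + i ≤ a

      Strict : ℕ → Set
      Strict a = i < a × a < 2 + d + i

      strict-or-outside : ∀ a → Strict a ⊎ Outside a
      strict-or-outside a with i ℕₚ.<? a | a ℕₚ.<? 2 + d + i
      ... | yes i<a | yes a<j = inj₁ (i<a , a<j)
      ... | no i≮a  | _       = inj₂ (inj₁ (ℕₚ.≮⇒≥ i≮a))
      ... | yes _   | no a≮j  = inj₂ (inj₂ (ℕₚ.≮⇒≥ a≮j))

      in-inner : ∀ {a b} → i ≤ a → a ≤ 2 + d + i → i ≤ b → b ≤ 2 + d + i → a ≢ b → f a ~ f b
      in-inner i≤a a≤j i≤b b≤j = clique-reindex inner-clique (inner-hits i≤a a≤j) (inner-hits i≤b b≤j)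

      in-outer : ∀ {a b} → a < 3 + d + i + r → b < 3 + d + i + r → Outside a → Outside b → a ≢ b → f a ~ f b
      in-outer a<L b<L oa ob = clique-reindex outer-clique (outer-hits a<L oa) (outer-hits b<L ob)

      across : ∀ {a b} → a < 3 + d + i + r → b < 3 + d + i + r → a ≢ b → Strict a → Outside b → f a ~ f b
      across {a} {b} a<L b<L a≢b (i<a , a<j) ob with b ℕ.≟ i | b ℕ.≟ 2 + d + i
      ... | yes refl | _ = in-inner (ℕₚ.<⇒≤ i<a) (ℕₚ.<⇒≤ a<j) ℕₚ.≤-refl i≤j a≢b
      ... | no _ | yes refl = in-inner (ℕₚ.<⇒≤ i<a) (ℕₚ.<⇒≤ a<j) i≤j ℕₚ.≤-refl a≢b
      ... | no b≢i | no b≢j = diamond-free⇒adjacent diamond-free (a≢b ∘ injective a b a<L b<L) chord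
          (in-inner ℕₚ.≤-refl i≤j (ℕₚ.<⇒≤ i<a) (ℕₚ.<⇒≤ a<j) (ℕₚ.<⇒≢ i<a))
          (in-outer i<L b<L (inj₁ ℕₚ.≤-refl) ob (b≢i ∘ sym))
          (in-inner i≤j ℕₚ.≤-refl (ℕₚ.<⇒≤ i<a) (ℕₚ.<⇒≤ a<j) (ℕₚ.<⇒≢ a<j ∘ sym))
          (in-outer j<L b<L (inj₂ ℕₚ.≤-refl) ob (b≢j ∘ sym))

      clique : IsClique f (3 + d + i + r)
      clique a b a<L b<L a≢b with strict-or-outside a | strict-or-outside b
      ... | inj₁ (i<a , a<j) | inj₁ (i<b , b<j) = in-inner (ℕₚ.<⇒≤ i<a) (ℕₚ.<⇒≤ a<j) (ℕₚ.<⇒≤ i<b) (ℕₚ.<⇒≤ b<j) a≢b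
      ... | inj₂ oa | inj₂ ob = in-outer a<L b<L oa ob a≢b
      ... | inj₁ sa | inj₂ ob = across a<L b<L a≢b sa ob
      ... | inj₂ oa | inj₁ sb = ~-sym (across b<L a<L (a≢b ∘ sym) sb oa)

  chord-shape : ∀ {i j L} → i < j → suc i ≢ j → j < L → ¬ (i ≡ 0 × j ≡ L ∸ 1) →
    Σ ℕ λ d → Σ ℕ λ r → j ≡ 2 + d + i × L ≡ 3 + d + i + r × 1 ≤ i + r
  chord-shape {i} {j} {L} i<j si≢j j<L not-ends = d , r , j≡ , L≡ , positive
    where
    d = j ∸ (2 + i)
    r = L ∸ suc j

    j≡ : j ≡ 2 + d + i
    j≡ = trans (sym (ℕₚ.m∸n+n≡m (ℕₚ.≤∧≢⇒< i<j si≢j)))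
               (solve 2 (λ d i → d :+ (con 2 :+ i) := con 2 :+ d :+ i) refl d i)

    L≡ : L ≡ 3 + d + i + r
    L≡ = trans (sym (ℕₚ.m+[n∸m]≡n j<L)) (cong (λ x → suc x + r) j≡)

    j-last : r ≡ 0 → j ≡ L ∸ 1
    j-last r≡0 = begin
      j                  ≡⟨ j≡ ⟩
      2 + d + i          ≡⟨ sym (ℕₚ.+-identityʳ (2 + d + i)) ⟩
      2 + d + i + 0      ≡⟨ cong (2 + d + i +_) (sym r≡0) ⟩
      2 + d + i + r      ≡⟨ cong (_∸ 1) (sym L≡) ⟩
      L ∸ 1              ∎
      where open ≡-Reasoning

    positive : 1 ≤ i + r
    positive with i ℕ.≟ 0 | r ℕ.≟ 0
    ... | yes i≡0 | yes r≡0 = ⊥-elim (not-ends (i≡0 , j-last r≡0))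
    ... | no i≢0  | _       = ℕₚ.≤-trans (ℕₚ.n≢0⇒n>0 i≢0) (ℕₚ.m≤m+n i r)
    ... | _       | no r≢0  = ℕₚ.≤-trans (ℕₚ.n≢0⇒n>0 r≢0) (ℕₚ.m≤n+m r i)

  oriented-chord⇒clique : DiamondFree G → ∀ {L f} → ShorterCyclesAreCliques L → Cycle L f →
    ∀ {i j} → i < j → suc i ≢ j → j < L → ¬ (i ≡ 0 × j ≡ L ∸ 1) → f i ~ f j → IsClique f L
  oriented-chord⇒clique diamond-free smaller cycle {i} i<j si≢j j<L not-ends chord
    with chord-shape i<j si≢j j<L not-ends
  ... | d , r , refl , refl , 1≤i+r = ChordSplit.chord-clique diamond-free i d r cycle chord smaller 1≤i+r

  cycle⇒clique : Chordal G → DiamondFree G → ∀ L {f} → 3 ≤ L → Cycle L f → IsClique f L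
  cycle⇒clique chordal diamond-free = <-rec _ step
    where
    step : ∀ L → (∀ {M} → M < L → ∀ {g} → 3 ≤ M → Cycle M g → IsClique g M) →
           ∀ {f} → 3 ≤ L → Cycle L f → IsClique f L
    step (suc zero)             _ (s≤s ()) _
    step (suc (suc zero))       _ (s≤s (s≤s ())) _
    step (suc (suc (suc zero))) _ _ cycle = triangle-clique cycle
    step L@(suc (suc (suc (suc _)))) smaller {f} _ cycle =
      clique-from-chord (chordal L (s≤s (s≤s (s≤s (s≤s z≤n)))) (f ∘ toℕ) (f∘toℕ-injective , f∘toℕ-cyclic))
      where
      open Cycle cycle

      f∘toℕ-injective : Injective (f ∘ toℕ)
      f∘toℕ-injective a b eq = toℕ-injective (injective _ _ (toℕ<n a) (toℕ<n b) eq)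

      closing′ : ∀ {a b : Fin L} → toℕ a ≡ 0 → toℕ b ≡ L ∸ 1 → f (toℕ a) ~ f (toℕ b)
      closing′ a≡0 b≡last = subst₂ (λ x y → f x ~ f y) (sym a≡0) (sym b≡last) closing

      consecutive : ∀ {a b : Fin L} → suc (toℕ a) ≡ toℕ b → f (toℕ a) ~ f (toℕ b)
      consecutive {a} {b} e = subst (λ x → f (toℕ a) ~ f x) e (walk (toℕ a) (subst (_< L) (sym e) (toℕ<n b)))

      f∘toℕ-cyclic : ∀ a b → CycAdj L a b → f (toℕ a) ~ f (toℕ b)
      f∘toℕ-cyclic a b (inj₁ e) = consecutive e
      f∘toℕ-cyclic a b (inj₂ (inj₁ e)) = ~-sym (consecutive e)
      f∘toℕ-cyclic a b (inj₂ (inj₂ (inj₁ (a≡0 , b≡last)))) = closing′ a≡0 b≡last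
      f∘toℕ-cyclic a b (inj₂ (inj₂ (inj₂ (b≡0 , a≡last)))) = ~-sym (closing′ b≡0 a≡last)

      oriented : ∀ {a b} → toℕ a < toℕ b → ¬ CycAdj L a b → f (toℕ a) ~ f (toℕ b) → IsClique f L
      oriented {a} {b} a<b ¬adj = oriented-chord⇒clique diamond-free (λ M<L → smaller M<L) cycle a<b
        (¬adj ∘ inj₁) (toℕ<n b) (¬adj ∘ inj₂ ∘ inj₂ ∘ inj₁)

      clique-from-chord : Σ[ a ∈ Fin L ] Σ[ b ∈ Fin L ] (a ≢ b × ¬ CycAdj L a b × f (toℕ a) ~ f (toℕ b)) →
                          IsClique f L
      clique-from-chord (a , b , a≢b , ¬adj , chord) with ℕₚ.<-cmp (toℕ a) (toℕ b)
      ... | tri< a<b _ _ = oriented a<b ¬adj chord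
      ... | tri≈ _ a≡b _ = ⊥-elim (a≢b (toℕ-injective a≡b))
      ... | tri> _ _ b<a = oriented b<a (¬adj ∘ CycAdj-sym) (~-sym chord)
        where
        CycAdj-sym : CycAdj L b a → CycAdj L a b
        CycAdj-sym (inj₁ e) = inj₂ (inj₁ e)
        CycAdj-sym (inj₂ (inj₁ e)) = inj₁ e
        CycAdj-sym (inj₂ (inj₂ (inj₁ e))) = inj₂ (inj₂ (inj₂ e))
        CycAdj-sym (inj₂ (inj₂ (inj₂ e))) = inj₂ (inj₂ (inj₁ e))

  Simplicial : Subset (n G) → V → Set
  Simplicial S v = v ∈ S × (∀ {x y} → x ∈ S → y ∈ S → x ≢ y → v ~ x → v ~ y → x ~ y)

  record Path (S : Subset (n G)) : Set where
    field
      length    : ℕ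
      vertex    : ℕ → V
      nonempty  : 1 ≤ length
      injective : InjectiveOn vertex length
      walk      : IsWalk vertex length
      inside    : ∀ a → a < length → vertex a ∈ S

    OnPath : V → Set
    OnPath = Hits vertex length

  open Path

  prepend : ∀ {S} (P : Path S) {w} → w ∈ S → vertex P 0 ~ w → ¬ OnPath P w → Path S
  prepend {S} P {w} w∈S first~w w∉P = record
    { length    = suc (length P)
    ; vertex    = vertex′
    ; nonempty  = s≤s z≤n
    ; injective = injective′
    ; walk      = walk′
    ; inside    = inside′
    }
    where
    vertex′ : ℕ → V
    vertex′ zero    = w
    vertex′ (suc a) = vertex P a

    injective′ : InjectiveOn vertex′ (suc (length P))
    injective′ zero    zero    _   _   _  = refl
    injective′ zero    (suc b) _   b<L eq = ⊥-elim (w∉P (b , ℕ.s≤s⁻¹ b<L , sym eq))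
    injective′ (suc a) zero    a<L _   eq = ⊥-elim (w∉P (a , ℕ.s≤s⁻¹ a<L , eq))
    injective′ (suc a) (suc b) a<L b<L eq = cong suc (injective P a b (ℕ.s≤s⁻¹ a<L) (ℕ.s≤s⁻¹ b<L) eq)

    walk′ : IsWalk vertex′ (suc (length P))
    walk′ zero    _   = ~-sym first~w
    walk′ (suc a) a<L = walk P a (ℕ.s≤s⁻¹ a<L)

    inside′ : ∀ a → a < suc (length P) → vertex′ a ∈ S
    inside′ zero    _   = w∈S
    inside′ (suc a) a<L = inside P a (ℕ.s≤s⁻¹ a<L)

  Maximal : ∀ {S} → Path S → Set
  Maximal {S} P = ∀ {w} → w ∈ S → vertex P 0 ~ w → OnPath P w

  path-length≤ : ∀ {S} (P : Path S) → length P ≤ n G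
  path-length≤ P = Finₚ.injective⇒≤ {f = vertex P ∘ toℕ}
    (λ {a} {b} eq → toℕ-injective (injective P _ _ (toℕ<n a) (toℕ<n b) eq))

  extend-to-maximal : ∀ {S} fuel (P : Path S) → n G < length P + fuel → Σ (Path S) Maximal
  extend-to-maximal zero P overlong =
    ⊥-elim (ℕₚ.<⇒≱ overlong (subst (_≤ n G) (sym (ℕₚ.+-identityʳ _)) (path-length≤ P)))
  extend-to-maximal {S} (suc fuel) P overlong
    with Finₚ.any? (λ w → (w ∈? S) ×-dec ((vertex P 0 ~? w) ×-dec ¬? (hits? Fin._≟_ (vertex P) (length P) w)))
  ... | yes (w , w∈S , first~w , w∉P) =
    extend-to-maximal fuel (prepend P w∈S first~w w∉P) (subst (n G <_) (ℕₚ.+-suc (length P) fuel) overlong)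
  ... | no no-extension = P , maximal
    where
    maximal : Maximal P
    maximal {w} w∈S first~w with hits? Fin._≟_ (vertex P) (length P) w
    ... | yes w∈P = w∈P
    ... | no w∉P  = ⊥-elim (no-extension (w , w∈S , first~w , w∉P))

  maximal-path-exists : ∀ {S v} → v ∈ S → Σ (Path S) Maximal
  maximal-path-exists {S} {v} v∈S = extend-to-maximal (n G) single (ℕₚ.n<1+n (n G))
    where
    single : Path S
    single = record
      { length    = 1
      ; vertex    = λ _ → v
      ; nonempty  = s≤s z≤n
      ; injective = λ { zero zero _ _ _ → refl ; (suc _) _ (s≤s ()) _ _ ; zero (suc _) _ (s≤s ()) _ }
      ; walk      = λ { _ (s≤s ()) }
      ; inside    = λ _ _ → v∈S
      }

  -- Every neighbour of the end of a maximal path lies on it, and closes a cycle with the path.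
  maximal-path-end-simplicial : Chordal G → DiamondFree G → ∀ {S} (P : Path S) → Maximal P →
                                Simplicial S (vertex P 0)
  maximal-path-end-simplicial chordal diamond-free {S} P maximal = inside P 0 (nonempty P) , neighbours-adjacent
    where
    prefix-cycle : ∀ b → b < length P → vertex P 0 ~ vertex P b → Cycle (suc b) (vertex P)
    prefix-cycle b b<L closing = record
      { injective = λ a a′ a< a′< → injective P a a′ (ℕₚ.<-≤-trans a< b<L) (ℕₚ.<-≤-trans a′< b<L)
      ; walk      = λ a sa< → walk P a (ℕₚ.<-≤-trans sa< b<L)
      ; closing   = closing
      }

    ordered : ∀ a b → b < length P → a < b → vertex P 0 ~ vertex P a → vertex P 0 ~ vertex P b →
              vertex P a ~ vertex P b
    ordered zero    b _   _   0~0 _     = ⊥-elim (~-irrefl 0~0)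
    ordered (suc a) b b<L a<b _   0~b = cycle⇒clique chordal diamond-free (suc b)
      (s≤s (ℕₚ.<-≤-trans (s≤s (s≤s z≤n)) a<b)) (prefix-cycle b b<L 0~b)
      (suc a) b (ℕₚ.m≤n⇒m≤1+n a<b) (ℕₚ.n<1+n b) (ℕₚ.<⇒≢ a<b)

    neighbours-adjacent : ∀ {x y} → x ∈ S → y ∈ S → x ≢ y → vertex P 0 ~ x → vertex P 0 ~ y → x ~ y
    neighbours-adjacent x∈S y∈S x≢y 0~x 0~y with maximal x∈S 0~x | maximal y∈S 0~y
    ... | a , a<L , refl | b , b<L , refl with ℕₚ.<-cmp a b
    ...   | tri< a<b _ _ = ordered a b b<L a<b 0~x 0~y
    ...   | tri≈ _ refl _ = ⊥-elim (x≢y refl)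
    ...   | tri> _ _ b<a = ~-sym (ordered b a a<L b<a 0~y 0~x)

  simplicial-exists : Chordal G → DiamondFree G → ∀ {S v} → v ∈ S → Σ V (Simplicial S)
  simplicial-exists chordal diamond-free v∈S with maximal-path-exists v∈S
  ... | P , maximal = vertex P 0 , maximal-path-end-simplicial chordal diamond-free P maximal


  -- Every entry of a position and
  -- every stamp is at most height, so an extension step can use suc height as a fresh value.
  record BlockModel (S : Subset (n G)) : Set where
    field
      height   : ℕ
      position : V → List Entry
      level    : V → ℕ
      blocks   : ℕ
      anchor   : Fin blocks → V
      stamp    : Fin blocks → ℕ

    infix 4 _∈ᵇ_
    _∈ᵇ_ : V → Fin blocks → Set
    w ∈ᵇ B = w ∈ S × blockKeys (position (anchor B)) (stamp B) ⋖ vertexKeys (position w) (level w)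

    field
      anchor-inside       : ∀ B → anchor B ∈ S
      position-injective  : ∀ {x y} → x ∈ S → y ∈ S → position x ≡ position y → x ≡ y
      position-bounded    : ∀ {x} → x ∈ S → All (Bounded height) (position x)
      level-bounded       : ∀ {x} → x ∈ S → level x ≤ 4 * height + 1
      stamp-bounded       : ∀ B → stamp B ≤ height
      stamp-injective     : ∀ {B B′} → stamp B ≡ stamp B′ → B ≡ B′
      anchor-before-stamp : ∀ B → All (λ e → proj₁ e < stamp B) (position (anchor B))
      two-members         : ∀ B → Σ V λ x → Σ V λ y → x ≢ y × x ∈ᵇ B × y ∈ᵇ B
      block-unique        : ∀ {B B′ x y} → x ≢ y → x ∈ᵇ B → y ∈ᵇ B → x ∈ᵇ B′ → y ∈ᵇ B′ → B ≡ B′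
      edge⇒block          : ∀ {x y} → x ∈ S → y ∈ S → x ≢ y → x ~ y → Σ (Fin blocks) λ B → x ∈ᵇ B × y ∈ᵇ B
      block⇒edge          : ∀ {B x y} → x ≢ y → x ∈ᵇ B → y ∈ᵇ B → x ~ y
      block-maximal       : ∀ {B w} → w ∈ S → (∀ {x} → x ∈ᵇ B → x ≢ w → w ~ x) → w ∈ᵇ B

  empty-model : ∀ {S} → (∀ {x} → x ∉ S) → BlockModel S
  empty-model ∉S = record
    { height = 0 ; position = λ _ → [] ; level = λ _ → 0 ; blocks = 0 ; anchor = λ () ; stamp = λ ()
    ; anchor-inside = λ () ; position-injective = λ x∈ → ⊥-elim (∉S x∈) ; position-bounded = λ x∈ → ⊥-elim (∉S x∈)
    ; level-bounded = λ x∈ → ⊥-elim (∉S x∈) ; stamp-bounded = λ () ; stamp-injective = λ {B} → case-Fin0 B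
    ; anchor-before-stamp = λ () ; two-members = λ () ; block-unique = λ {B} → case-Fin0 B
    ; edge⇒block = λ x∈ → ⊥-elim (∉S x∈) ; block⇒edge = λ {B} → case-Fin0 B ; block-maximal = λ {B} → case-Fin0 B
    }
    where
    case-Fin0 : ∀ {A : Set} → Fin 0 → A
    case-Fin0 ()

  update : ∀ {X : Set} → (V → X) → V → X → V → X
  update f v a x with x Fin.≟ v
  ... | yes _ = a
  ... | no _  = f x

  update-same : ∀ {X : Set} (f : V → X) v a → update f v a v ≡ a
  update-same f v a with v Fin.≟ v
  ... | yes _  = refl
  ... | no v≢v = ⊥-elim (v≢v refl)

  update-other : ∀ {X : Set} (f : V → X) v a {x} → x ≢ v → update f v a x ≡ f x
  update-other f v a {x} x≢v with x Fin.≟ v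
  ... | yes x≡v = ⊥-elim (x≢v x≡v)
  ... | no _    = refl

  module Extension {S : Subset (n G)} {v : V} (v∈S : v ∈ S) (M : BlockModel (S - v)) where

    open BlockModel M

    ∈⁻⇒∈ : ∀ {x} → x ∈ S - v → x ∈ S
    ∈⁻⇒∈ = p─q⊆p S ⁅ v ⁆

    ∈⇒∈⁻ : ∀ {x} → x ∈ S → x ≢ v → x ∈ S - v
    ∈⇒∈⁻ = x∈p∧x≢y⇒x∈p-y

    ∈⁻⇒≢v : ∀ {x} → x ∈ S - v → x ≢ v
    ∈⁻⇒≢v {x} x∈ refl = x∉p-x S x x∈

    anchor≢v : ∀ B → anchor B ≢ v
    anchor≢v B = ∈⁻⇒≢v (anchor-inside B)

    module Placement (p : List Entry) (ℓ : ℕ) where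

      position′ : V → List Entry
      position′ = update position v p

      level′ : V → ℕ
      level′ = update level v ℓ

      InBlock′ : V → ℕ → V → Set
      InBlock′ a s w = w ∈ S × blockKeys (position′ a) s ⋖ vertexKeys (position′ w) (level′ w)

      InBlock : V → ℕ → V → Set
      InBlock a s w = w ∈ S - v × blockKeys (position a) s ⋖ vertexKeys (position w) (level w)

      agree : ∀ {a s w} → a ≢ v → w ≢ v →
        (blockKeys (position′ a) s ⋖ vertexKeys (position′ w) (level′ w)) ≡
        (blockKeys (position a) s ⋖ vertexKeys (position w) (level w))
      agree a≢v w≢v rewrite update-other position v p a≢v | update-other position v p w≢v
                          | update-other level v ℓ w≢v = refl

      agree-at-v : ∀ {a s} → a ≢ v →
        (blockKeys (position′ a) s ⋖ vertexKeys (position′ v) (level′ v)) ≡ (blockKeys (position a) s ⋖ vertexKeys p ℓ)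
      agree-at-v a≢v rewrite update-other position v p a≢v | update-same position v p | update-same level v ℓ = refl

      InBlock⇒′ : ∀ {a s w} → a ≢ v → InBlock a s w → InBlock′ a s w
      InBlock⇒′ a≢v (w∈ , below) = ∈⁻⇒∈ w∈ , subst id (sym (agree a≢v (∈⁻⇒≢v w∈))) below

      InBlock′⇒ : ∀ {a s w} → a ≢ v → w ≢ v → InBlock′ a s w → InBlock a s w
      InBlock′⇒ a≢v w≢v (w∈ , below) = ∈⇒∈⁻ w∈ w≢v , subst id (agree a≢v w≢v) below

      v-InBlock′⇒ : ∀ {a s} → a ≢ v → InBlock′ a s v → blockKeys (position a) s ⋖ vertexKeys p ℓ
      v-InBlock′⇒ a≢v (_ , below) = subst id (agree-at-v a≢v) below

      ⇒v-InBlock′ : ∀ {a s} → a ≢ v → blockKeys (position a) s ⋖ vertexKeys p ℓ → InBlock′ a s v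
      ⇒v-InBlock′ a≢v below = v∈S , subst id (sym (agree-at-v a≢v)) below

      position′-injective : (∀ {w} → w ∈ S - v → p ≢ position w) →
                            ∀ {x y} → x ∈ S → y ∈ S → position′ x ≡ position′ y → x ≡ y
      position′-injective p-fresh {x} {y} x∈ y∈ eq = by-cases (x Fin.≟ v) (y Fin.≟ v)
        where
        by-cases : Dec (x ≡ v) → Dec (y ≡ v) → x ≡ y
        by-cases (yes refl) (yes refl) = refl
        by-cases (yes refl) (no y≢v) = ⊥-elim (p-fresh (∈⇒∈⁻ y∈ y≢v)
          (trans (sym (update-same position v p)) (trans eq (update-other position v p y≢v))))
        by-cases (no x≢v) (yes refl) = ⊥-elim (p-fresh (∈⇒∈⁻ x∈ x≢v)
          (trans (sym (update-same position v p)) (trans (sym eq) (update-other position v p x≢v))))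
        by-cases (no x≢v) (no y≢v) = position-injective (∈⇒∈⁻ x∈ x≢v) (∈⇒∈⁻ y∈ y≢v)
          (trans (sym (update-other position v p x≢v)) (trans eq (update-other position v p y≢v)))

      position′-bounded : All (Bounded (suc height)) p → ∀ {x} → x ∈ S → All (Bounded (suc height)) (position′ x)
      position′-bounded p-bounded {x} x∈ = by-cases (x Fin.≟ v)
        where
        by-cases : Dec (x ≡ v) → All (Bounded (suc height)) (position′ x)
        by-cases (yes refl) = subst (All (Bounded (suc height))) (sym (update-same position v p)) p-bounded
        by-cases (no x≢v) = subst (All (Bounded (suc height))) (sym (update-other position v p x≢v))
                              (bounded-suc (position-bounded (∈⇒∈⁻ x∈ x≢v)))

      level′-bounded : ℓ ≤ 4 * suc height + 1 → ∀ {x} → x ∈ S → level′ x ≤ 4 * suc height + 1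
      level′-bounded ℓ-bounded {x} x∈ = by-cases (x Fin.≟ v)
        where
        by-cases : Dec (x ≡ v) → level′ x ≤ 4 * suc height + 1
        by-cases (yes refl) = subst (_≤ 4 * suc height + 1) (sym (update-same level v ℓ)) ℓ-bounded
        by-cases (no x≢v) = subst (_≤ 4 * suc height + 1) (sym (update-other level v ℓ x≢v))
                              (ℕₚ.≤-trans (level-bounded (∈⇒∈⁻ x∈ x≢v)) (4*-mono 1 (ℕₚ.n≤1+n height)))

      anchor-before-stamp′ : ∀ B → All (λ e → proj₁ e < stamp B) (position′ (anchor B))
      anchor-before-stamp′ B = subst (All (λ e → proj₁ e < stamp B)) (sym (update-other position v p (anchor≢v B)))
                                     (anchor-before-stamp B)

      infix 4 _∈ᵇ′_
      _∈ᵇ′_ : V → Fin blocks → Set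
      w ∈ᵇ′ B = InBlock′ (anchor B) (stamp B) w

      ∈ᵇ⇒∈ᵇ′ : ∀ {B w} → w ∈ᵇ B → w ∈ᵇ′ B
      ∈ᵇ⇒∈ᵇ′ {B} = InBlock⇒′ (anchor≢v B)

      ∈ᵇ′⇒∈ᵇ : ∀ {B w} → w ∈ᵇ′ B → w ≢ v → w ∈ᵇ B
      ∈ᵇ′⇒∈ᵇ {B} w∈ w≢v = InBlock′⇒ (anchor≢v B) w≢v w∈

      two-members′ : ∀ B → Σ V λ x → Σ V λ y → x ≢ y × x ∈ᵇ′ B × y ∈ᵇ′ B
      two-members′ B with two-members B
      ... | x , y , x≢y , x∈B , y∈B = x , y , x≢y , ∈ᵇ⇒∈ᵇ′ x∈B , ∈ᵇ⇒∈ᵇ′ y∈B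

      edge⇒old-block : ∀ {y z} → y ∈ S → z ∈ S → y ≢ v → z ≢ v → y ≢ z → y ~ z →
                       Σ (Fin blocks) λ B → y ∈ᵇ′ B × z ∈ᵇ′ B
      edge⇒old-block y∈ z∈ y≢v z≢v y≢z y~z with edge⇒block (∈⇒∈⁻ y∈ y≢v) (∈⇒∈⁻ z∈ z≢v) y≢z y~z
      ... | B , y∈B , z∈B = B , ∈ᵇ⇒∈ᵇ′ y∈B , ∈ᵇ⇒∈ᵇ′ z∈B

      old-block-maximal : ∀ {B w} → w ∈ S → w ≢ v → (∀ {z} → z ∈ᵇ′ B → z ≢ w → w ~ z) → w ∈ᵇ′ B
      old-block-maximal w∈ w≢v adjacent = ∈ᵇ⇒∈ᵇ′ (block-maximal (∈⇒∈⁻ w∈ w≢v) λ z∈B z≢w → adjacent (∈ᵇ⇒∈ᵇ′ z∈B) z≢w)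

    isolated : (∀ {w} → w ∈ S - v → ¬ v ~ w) → BlockModel S
    isolated no-neighbour = record
      { height              = suc height
      ; position            = position′
      ; level               = level′
      ; blocks              = blocks
      ; anchor              = anchor
      ; stamp               = stamp
      ; anchor-inside       = ∈⁻⇒∈ ∘ anchor-inside
      ; position-injective  = position′-injective p-fresh
      ; position-bounded    = position′-bounded ((ℕₚ.≤-refl , ℕₚ.≤-refl) ∷ [])
      ; level-bounded       = level′-bounded (ℕₚ.m≤m+n (4 * suc height) 1)
      ; stamp-bounded       = ℕₚ.m≤n⇒m≤1+n ∘ stamp-bounded
      ; stamp-injective     = stamp-injective
      ; anchor-before-stamp = anchor-before-stamp′
      ; two-members         = two-members′
      ; block-unique        = λ x≢y x∈B y∈B x∈B′ y∈B′ →
          block-unique x≢y (old x∈B) (old y∈B) (old x∈B′) (old y∈B′)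
      ; edge⇒block          = edge⇒block′
      ; block⇒edge          = λ x≢y x∈B y∈B → block⇒edge x≢y (old x∈B) (old y∈B)
      ; block-maximal       = block-maximal′
      }
      where
      open Placement [ (suc height , suc height) ] (4 * suc height)

      p-fresh : ∀ {w} → w ∈ S - v → [ (suc height , suc height) ] ≢ position w
      p-fresh w∈ eq = fresh-entry-unbounded [] (suc height) (subst (All (Bounded height)) (sym eq) (position-bounded w∈))

      v∉ : ∀ B → ¬ v ∈ᵇ′ B
      v∉ B v∈B = high-level-not-⋖ (position (anchor B)) _ (stamp B) (stamp-bounded B) (v-InBlock′⇒ (anchor≢v B) v∈B)

      old : ∀ {B w} → w ∈ᵇ′ B → w ∈ᵇ B
      old {B} {w} w∈B = ∈ᵇ′⇒∈ᵇ w∈B λ { refl → v∉ B w∈B }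

      edge⇒block′ : ∀ {x y} → x ∈ S → y ∈ S → x ≢ y → x ~ y → Σ (Fin blocks) λ B → x ∈ᵇ′ B × y ∈ᵇ′ B
      edge⇒block′ {x} {y} x∈ y∈ x≢y x~y = by-cases (x Fin.≟ v) (y Fin.≟ v)
        where
        by-cases : Dec (x ≡ v) → Dec (y ≡ v) → Σ (Fin blocks) λ B → x ∈ᵇ′ B × y ∈ᵇ′ B
        by-cases (yes refl) _ = ⊥-elim (no-neighbour (∈⇒∈⁻ y∈ (x≢y ∘ sym)) x~y)
        by-cases (no x≢v) (yes refl) = ⊥-elim (no-neighbour (∈⇒∈⁻ x∈ x≢v) (~-sym x~y))
        by-cases (no x≢v) (no y≢v) = edge⇒old-block x∈ y∈ x≢v y≢v x≢y x~y

      block-maximal′ : ∀ {B w} → w ∈ S → (∀ {x} → x ∈ᵇ′ B → x ≢ w → w ~ x) → w ∈ᵇ′ B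
      block-maximal′ {B} {w} w∈ adjacent = by-cases (w Fin.≟ v)
        where
        by-cases : Dec (w ≡ v) → w ∈ᵇ′ B
        by-cases (yes refl) with two-members B
        ... | z , _ , _ , z∈B , _ = ⊥-elim (no-neighbour (proj₁ z∈B) (adjacent (∈ᵇ⇒∈ᵇ′ z∈B) (∈⁻⇒≢v (proj₁ z∈B))))
        by-cases (no w≢v) = old-block-maximal w∈ w≢v adjacent

    pendant : ∀ {x} → x ∈ S - v → v ~ x → (∀ {w} → w ∈ S - v → v ~ w → w ≡ x) → BlockModel S
    pendant {x} x∈ v~x only-x = record
      { height              = suc height
      ; position            = position′
      ; level               = level′
      ; blocks              = suc blocks
      ; anchor              = anchor′
      ; stamp               = stamp′
      ; anchor-inside       = anchor-inside′
      ; position-injective  = position′-injective p-fresh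
      ; position-bounded    = position′-bounded (AllP.++⁺ (bounded-suc (position-bounded x∈)) ((ℕₚ.≤-refl , ℕₚ.≤-refl) ∷ []))
      ; level-bounded       = level′-bounded (ℕₚ.m≤m+n (4 * suc height) 1)
      ; stamp-bounded       = stamp-bounded′
      ; stamp-injective     = stamp-injective′
      ; anchor-before-stamp = anchor-before-stamp″
      ; two-members         = two-members″
      ; block-unique        = block-unique′
      ; edge⇒block          = edge⇒block′
      ; block⇒edge          = λ {B} → block⇒edge′ {B}
      ; block-maximal       = λ {B} → block-maximal′ {B}
      }
      where
      p : List Entry
      p = position x ++ [ (suc height , suc height) ]

      open Placement p (4 * suc height)

      x≢v : x ≢ v
      x≢v = ∈⁻⇒≢v x∈

      anchor′ : Fin (suc blocks) → V
      anchor′ zero    = x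
      anchor′ (suc B) = anchor B

      stamp′ : Fin (suc blocks) → ℕ
      stamp′ zero    = suc height
      stamp′ (suc B) = stamp B

      infix 4 _∈ₙ_
      _∈ₙ_ : V → Fin (suc blocks) → Set
      w ∈ₙ B = InBlock′ (anchor′ B) (stamp′ B) w

      p-fresh : ∀ {w} → w ∈ S - v → p ≢ position w
      p-fresh w∈ eq = fresh-entry-unbounded (position x) (suc height)
                        (subst (All (Bounded height)) (sym eq) (position-bounded w∈))

      anchor-inside′ : ∀ B → anchor′ B ∈ S
      anchor-inside′ zero    = ∈⁻⇒∈ x∈
      anchor-inside′ (suc B) = ∈⁻⇒∈ (anchor-inside B)

      stamp-bounded′ : ∀ B → stamp′ B ≤ suc height
      stamp-bounded′ zero    = ℕₚ.≤-refl
      stamp-bounded′ (suc B) = ℕₚ.m≤n⇒m≤1+n (stamp-bounded B)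

      stamp-injective′ : ∀ {B B′} → stamp′ B ≡ stamp′ B′ → B ≡ B′
      stamp-injective′ {zero}  {zero}   _  = refl
      stamp-injective′ {zero}  {suc B′} eq = ⊥-elim (ℕₚ.<-irrefl refl (subst (_≤ height) (sym eq) (stamp-bounded B′)))
      stamp-injective′ {suc B} {zero}   eq = ⊥-elim (ℕₚ.<-irrefl refl (subst (_≤ height) eq (stamp-bounded B)))
      stamp-injective′ {suc B} {suc B′} eq = cong suc (stamp-injective eq)

      anchor-before-stamp″ : ∀ B → All (λ e → proj₁ e < stamp′ B) (position′ (anchor′ B))
      anchor-before-stamp″ zero    = subst (All (λ e → proj₁ e < suc height)) (sym (update-other position v p x≢v))
                                           (bounded⇒first< (position-bounded x∈))
      anchor-before-stamp″ (suc B) = anchor-before-stamp′ B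

      v∈new : v ∈ₙ zero
      v∈new = ⇒v-InBlock′ x≢v (⋖-child (position x) (suc height) (suc height) (4 * suc height) (s≤s z≤n)
                                        (ℕₚ.m<m+n (4 * suc height) (s≤s z≤n)))

      x∈new : x ∈ₙ zero
      x∈new = InBlock⇒′ x≢v (x∈ , ⋖-anchor (position x) (suc height) (level x) level<)
        where
        level< : level x < 4 * suc height + 2
        level< = ℕₚ.≤-<-trans (level-bounded x∈)
                   (ℕₚ.<-≤-trans (ℕₚ.+-monoʳ-< (4 * height) (s≤s (s≤s z≤n))) (4*-mono 2 (ℕₚ.n≤1+n height)))

      only-anchor : ∀ {w} → w ∈ₙ zero → w ≢ v → w ≡ x
      only-anchor {w} w∈B w≢v with InBlock′⇒ x≢v w≢v w∈B
      ... | w∈ , below = position-injective w∈ x∈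
                           (fresh-block-member-is-anchor (position x) (position w) (level w) (position-bounded w∈) below)

      v∉old : ∀ B → ¬ v ∈ₙ suc B
      v∉old B v∈B = high-level-not-⋖ (position (anchor B)) p (stamp B) (stamp-bounded B) (v-InBlock′⇒ (anchor≢v B) v∈B)

      v-only-in-new : ∀ {B} → v ∈ₙ B → B ≡ zero
      v-only-in-new {zero}  _   = refl
      v-only-in-new {suc B} v∈B = ⊥-elim (v∉old B v∈B)

      old : ∀ {B w} → w ∈ₙ suc B → w ∈ᵇ B
      old {B} w∈B = ∈ᵇ′⇒∈ᵇ w∈B λ { refl → v∉old B w∈B }

      two-members″ : ∀ B → Σ V λ y → Σ V λ z → y ≢ z × y ∈ₙ B × z ∈ₙ B
      two-members″ zero    = v , x , x≢v ∘ sym , v∈new , x∈new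
      two-members″ (suc B) = two-members′ B

      block-unique′ : ∀ {B B′ y z} → y ≢ z → y ∈ₙ B → z ∈ₙ B → y ∈ₙ B′ → z ∈ₙ B′ → B ≡ B′
      block-unique′ {B} {B′} {y} {z} y≢z y∈B z∈B y∈B′ z∈B′ = by-cases (y Fin.≟ v) (z Fin.≟ v)
        where
        same-anchor : y ≢ v → z ≢ v → ∀ {C} → y ∈ₙ C → z ∈ₙ C → C ≢ zero
        same-anchor y≢v z≢v y∈C z∈C refl = y≢z (trans (only-anchor y∈C y≢v) (sym (only-anchor z∈C z≢v)))

        by-cases : Dec (y ≡ v) → Dec (z ≡ v) → B ≡ B′
        by-cases (yes refl) _ = trans (v-only-in-new y∈B) (sym (v-only-in-new y∈B′))
        by-cases (no _) (yes refl) = trans (v-only-in-new z∈B) (sym (v-only-in-new z∈B′))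
        by-cases (no y≢v) (no z≢v) = by-blocks B B′ y∈B z∈B y∈B′ z∈B′
          where
          by-blocks : ∀ C C′ → y ∈ₙ C → z ∈ₙ C → y ∈ₙ C′ → z ∈ₙ C′ → C ≡ C′
          by-blocks zero    _        y∈C z∈C _    _    = ⊥-elim (same-anchor y≢v z≢v y∈C z∈C refl)
          by-blocks (suc _) zero     _   _   y∈C′ z∈C′ = ⊥-elim (same-anchor y≢v z≢v y∈C′ z∈C′ refl)
          by-blocks (suc _) (suc _)  y∈C z∈C y∈C′ z∈C′ = cong suc (block-unique y≢z (old y∈C) (old z∈C) (old y∈C′) (old z∈C′))

      edge⇒block′ : ∀ {y z} → y ∈ S → z ∈ S → y ≢ z → y ~ z → Σ (Fin (suc blocks)) λ B → y ∈ₙ B × z ∈ₙ B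
      edge⇒block′ {y} {z} y∈ z∈ y≢z y~z = by-cases (y Fin.≟ v) (z Fin.≟ v)
        where
        by-cases : Dec (y ≡ v) → Dec (z ≡ v) → Σ (Fin (suc blocks)) λ B → y ∈ₙ B × z ∈ₙ B
        by-cases (yes refl) _ = zero , v∈new , subst (_∈ₙ zero) (sym (only-x (∈⇒∈⁻ z∈ (y≢z ∘ sym)) y~z)) x∈new
        by-cases (no y≢v) (yes refl) = zero , subst (_∈ₙ zero) (sym (only-x (∈⇒∈⁻ y∈ y≢v) (~-sym y~z))) x∈new , v∈new
        by-cases (no y≢v) (no z≢v) with edge⇒old-block y∈ z∈ y≢v z≢v y≢z y~z
        ... | B , y∈B , z∈B = suc B , y∈B , z∈B

      block⇒edge′ : ∀ {B y z} → y ≢ z → y ∈ₙ B → z ∈ₙ B → y ~ z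
      block⇒edge′ {B} {y} {z} y≢z y∈B z∈B = by-cases B (y Fin.≟ v) (z Fin.≟ v) y∈B z∈B
        where
        by-cases : ∀ B → Dec (y ≡ v) → Dec (z ≡ v) → y ∈ₙ B → z ∈ₙ B → y ~ z
        by-cases zero (yes refl) _ _ z∈B = subst (v ~_) (sym (only-anchor z∈B (y≢z ∘ sym))) v~x
        by-cases zero (no y≢v) (yes refl) y∈B _ = ~-sym (subst (v ~_) (sym (only-anchor y∈B y≢v)) v~x)
        by-cases zero (no y≢v) (no z≢v) y∈B z∈B = ⊥-elim (y≢z (trans (only-anchor y∈B y≢v) (sym (only-anchor z∈B z≢v))))
        by-cases (suc C) (yes refl) _ y∈B _ = ⊥-elim (v∉old C y∈B)
        by-cases (suc C) (no _) (yes refl) _ z∈B = ⊥-elim (v∉old C z∈B)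
        by-cases (suc C) (no _) (no _) y∈B z∈B = block⇒edge y≢z (old y∈B) (old z∈B)

      block-maximal′ : ∀ {B w} → w ∈ S → (∀ {y} → y ∈ₙ B → y ≢ w → w ~ y) → w ∈ₙ B
      block-maximal′ {B} {w} w∈ adjacent = by-cases B (w Fin.≟ v) adjacent
        where
        by-cases : ∀ B → Dec (w ≡ v) → (∀ {y} → y ∈ₙ B → y ≢ w → w ~ y) → w ∈ₙ B
        by-cases zero (yes refl) _ = v∈new
        by-cases zero (no w≢v) adjacent =
          subst (_∈ₙ zero) (sym (only-x (∈⇒∈⁻ w∈ w≢v) (~-sym (adjacent v∈new (w≢v ∘ sym))))) x∈new
        by-cases (suc C) (yes refl) adjacent with two-members C
        ... | z₁ , z₂ , z₁≢z₂ , z₁∈C , z₂∈C = ⊥-elim (z₁≢z₂ (trans (only-neighbour z₁∈C) (sym (only-neighbour z₂∈C))))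
          where
          only-neighbour : ∀ {z} → z ∈ᵇ C → z ≡ x
          only-neighbour z∈C = only-x (proj₁ z∈C) (adjacent (∈ᵇ⇒∈ᵇ′ z∈C) (∈⁻⇒≢v (proj₁ z∈C)))
        by-cases (suc C) (no w≢v) adjacent = old-block-maximal w∈ w≢v adjacent

    member : ∀ B₀ → (∀ {w} → w ∈ S - v → v ~ w → w ∈ᵇ B₀) → (∀ {w} → w ∈ᵇ B₀ → v ~ w) → BlockModel S
    member B₀ neighbours⊆B₀ B₀⊆neighbours = record
      { height              = suc height
      ; position            = position′
      ; level               = level′
      ; blocks              = blocks
      ; anchor              = anchor
      ; stamp               = stamp
      ; anchor-inside       = ∈⁻⇒∈ ∘ anchor-inside
      ; position-injective  = position′-injective p-fresh
      ; position-bounded    = position′-bounded (AllP.++⁺ (bounded-suc (position-bounded (anchor-inside B₀)))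
                                                         ((ℕₚ.m≤n⇒m≤1+n (stamp-bounded B₀) , ℕₚ.≤-refl) ∷ []))
      ; level-bounded       = level′-bounded (4*-mono 1 (ℕₚ.m≤n⇒m≤1+n (stamp-bounded B₀)))
      ; stamp-bounded       = ℕₚ.m≤n⇒m≤1+n ∘ stamp-bounded
      ; stamp-injective     = stamp-injective
      ; anchor-before-stamp = anchor-before-stamp′
      ; two-members         = two-members′
      ; block-unique        = block-unique′
      ; edge⇒block          = edge⇒block′
      ; block⇒edge          = λ {B} → block⇒edge′ {B}
      ; block-maximal       = λ {B} → block-maximal′ {B}
      }
      where
      p : List Entry
      p = position (anchor B₀) ++ [ (stamp B₀ , suc height) ]

      open Placement p (4 * stamp B₀ + 1)

      p-fresh : ∀ {w} → w ∈ S - v → p ≢ position w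
      p-fresh w∈ eq = fresh-entry-unbounded (position (anchor B₀)) (stamp B₀)
                        (subst (All (Bounded height)) (sym eq) (position-bounded w∈))

      v∈B₀ : v ∈ᵇ′ B₀
      v∈B₀ = ⇒v-InBlock′ (anchor≢v B₀) (⋖-child (position (anchor B₀)) (stamp B₀) (suc height) (4 * stamp B₀ + 1)
                                                (s≤s z≤n) (ℕₚ.+-monoʳ-< (4 * stamp B₀) (s≤s (s≤s z≤n))))

      v-only-in-B₀ : ∀ {B} → v ∈ᵇ′ B → B ≡ B₀
      v-only-in-B₀ {B} v∈B with B Fin.≟ B₀
      ... | yes B≡B₀ = B≡B₀
      ... | no B≢B₀  = ⊥-elim (new-member-in-one-block (position (anchor B₀)) (stamp B₀) (position (anchor B)) (stamp B)
                         (anchor-before-stamp B₀) (position-bounded (anchor-inside B)) (B≢B₀ ∘ stamp-injective ∘ sym)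
                         (v-InBlock′⇒ (anchor≢v B) v∈B))

      block-unique′ : ∀ {B B′ y z} → y ≢ z → y ∈ᵇ′ B → z ∈ᵇ′ B → y ∈ᵇ′ B′ → z ∈ᵇ′ B′ → B ≡ B′
      block-unique′ {B} {B′} {y} {z} y≢z y∈B z∈B y∈B′ z∈B′ = by-cases (y Fin.≟ v) (z Fin.≟ v)
        where
        by-cases : Dec (y ≡ v) → Dec (z ≡ v) → B ≡ B′
        by-cases (yes refl) _ = trans (v-only-in-B₀ y∈B) (sym (v-only-in-B₀ y∈B′))
        by-cases (no _) (yes refl) = trans (v-only-in-B₀ z∈B) (sym (v-only-in-B₀ z∈B′))
        by-cases (no y≢v) (no z≢v) =
          block-unique y≢z (∈ᵇ′⇒∈ᵇ y∈B y≢v) (∈ᵇ′⇒∈ᵇ z∈B z≢v) (∈ᵇ′⇒∈ᵇ y∈B′ y≢v) (∈ᵇ′⇒∈ᵇ z∈B′ z≢v)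

      edge⇒block′ : ∀ {y z} → y ∈ S → z ∈ S → y ≢ z → y ~ z → Σ (Fin blocks) λ B → y ∈ᵇ′ B × z ∈ᵇ′ B
      edge⇒block′ {y} {z} y∈ z∈ y≢z y~z = by-cases (y Fin.≟ v) (z Fin.≟ v)
        where
        by-cases : Dec (y ≡ v) → Dec (z ≡ v) → Σ (Fin blocks) λ B → y ∈ᵇ′ B × z ∈ᵇ′ B
        by-cases (yes refl) _ = B₀ , v∈B₀ , ∈ᵇ⇒∈ᵇ′ (neighbours⊆B₀ (∈⇒∈⁻ z∈ (y≢z ∘ sym)) y~z)
        by-cases (no y≢v) (yes refl) = B₀ , ∈ᵇ⇒∈ᵇ′ (neighbours⊆B₀ (∈⇒∈⁻ y∈ y≢v) (~-sym y~z)) , v∈B₀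
        by-cases (no y≢v) (no z≢v) = edge⇒old-block y∈ z∈ y≢v z≢v y≢z y~z

      block⇒edge′ : ∀ {B y z} → y ≢ z → y ∈ᵇ′ B → z ∈ᵇ′ B → y ~ z
      block⇒edge′ {B} {y} {z} y≢z y∈B z∈B = by-cases (y Fin.≟ v) (z Fin.≟ v)
        where
        by-cases : Dec (y ≡ v) → Dec (z ≡ v) → y ~ z
        by-cases (yes refl) _ = B₀⊆neighbours (subst (z ∈ᵇ_) (v-only-in-B₀ y∈B) (∈ᵇ′⇒∈ᵇ z∈B (y≢z ∘ sym)))
        by-cases (no y≢v) (yes refl) = ~-sym (B₀⊆neighbours (subst (y ∈ᵇ_) (v-only-in-B₀ z∈B) (∈ᵇ′⇒∈ᵇ y∈B y≢v)))
        by-cases (no y≢v) (no z≢v) = block⇒edge y≢z (∈ᵇ′⇒∈ᵇ y∈B y≢v) (∈ᵇ′⇒∈ᵇ z∈B z≢v)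

      block-maximal′ : ∀ {B w} → w ∈ S → (∀ {y} → y ∈ᵇ′ B → y ≢ w → w ~ y) → w ∈ᵇ′ B
      block-maximal′ {B} {w} w∈ adjacent = by-cases (w Fin.≟ v)
        where
        by-cases : Dec (w ≡ v) → w ∈ᵇ′ B
        by-cases (yes refl) with B Fin.≟ B₀
        ... | yes refl = v∈B₀
        ... | no B≢B₀ with two-members B
        ...   | z₁ , z₂ , z₁≢z₂ , z₁∈B , z₂∈B =
          ⊥-elim (B≢B₀ (block-unique z₁≢z₂ z₁∈B z₂∈B (in-B₀ z₁∈B) (in-B₀ z₂∈B)))
          where
          in-B₀ : ∀ {z} → z ∈ᵇ B → z ∈ᵇ B₀
          in-B₀ z∈B = neighbours⊆B₀ (proj₁ z∈B) (adjacent (∈ᵇ⇒∈ᵇ′ z∈B) (∈⁻⇒≢v (proj₁ z∈B)))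
        by-cases (no w≢v) = old-block-maximal w∈ w≢v adjacent

  extend-model : DiamondFree G → ∀ {S v} → Simplicial S v → BlockModel (S - v) → BlockModel S
  extend-model diamond-free {S} {v} (v∈S , simplicial) M
    with Finₚ.any? (λ w → (w ∈? S - v) ×-dec (v ~? w))
  ... | no no-neighbour = isolated λ w∈ v~w → no-neighbour (_ , w∈ , v~w)
    where open Extension v∈S M
  ... | yes (x , x∈ , v~x) with Finₚ.any? (λ w → (w ∈? S - v) ×-dec ((v ~? w) ×-dec ¬? (w Fin.≟ x)))
  ...   | no no-other = pendant x∈ v~x only-x
    where
    open Extension v∈S M
    only-x : ∀ {w} → w ∈ S - v → v ~ w → w ≡ x
    only-x {w} w∈ v~w with w Fin.≟ x
    ... | yes w≡x = w≡x
    ... | no w≢x  = ⊥-elim (no-other (w , w∈ , v~w , w≢x))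
  ...   | yes (y , y∈ , v~y , y≢x) = neighbourhood-is-block (edge⇒block x∈ y∈ (y≢x ∘ sym) x~y)
    where
    open Extension v∈S M
    open BlockModel M

    x~y : x ~ y
    x~y = simplicial (∈⁻⇒∈ x∈) (∈⁻⇒∈ y∈) (y≢x ∘ sym) v~x v~y

    neighbourhood-is-block : Σ (Fin blocks) (λ B → x ∈ᵇ B × y ∈ᵇ B) → BlockModel S
    neighbourhood-is-block (B₀ , x∈B₀ , y∈B₀) = member B₀ neighbours⊆B₀ B₀⊆neighbours
      where
      B₀⊆neighbours : ∀ {w} → w ∈ᵇ B₀ → v ~ w
      B₀⊆neighbours {w} w∈B₀ with w Fin.≟ x | w Fin.≟ y
      ... | yes refl | _        = v~x
      ... | no _     | yes refl = v~y
      ... | no w≢x   | no w≢y   = ~-sym (diamond-free⇒adjacent diamond-free (∈⁻⇒≢v (proj₁ w∈B₀)) x~y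
                                    (block⇒edge (w≢x ∘ sym) x∈B₀ w∈B₀) (~-sym v~x)
                                    (block⇒edge (w≢y ∘ sym) y∈B₀ w∈B₀) (~-sym v~y))

      neighbours⊆B₀ : ∀ {w} → w ∈ S - v → v ~ w → w ∈ᵇ B₀
      neighbours⊆B₀ w∈ v~w = block-maximal w∈ λ z∈B₀ z≢w →
        simplicial (∈⁻⇒∈ w∈) (∈⁻⇒∈ (proj₁ z∈B₀)) (z≢w ∘ sym) v~w (B₀⊆neighbours z∈B₀)

  block-model : Chordal G → DiamondFree G → ∀ S → BlockModel S
  block-model chordal diamond-free S = build (n G) S (∣p∣≤n S)
    where
    build : ∀ fuel S → ∣ S ∣ ≤ fuel → BlockModel S
    build zero S |S|≤0 = empty-model λ x∈ → ℕₚ.n≮0 (ℕₚ.<-≤-trans (x∈p⇒∣p-x∣<∣p∣ x∈) |S|≤0)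
    build (suc fuel) S |S|≤ with nonempty? S
    ... | no empty = empty-model λ x∈ → empty (_ , x∈)
    ... | yes (_ , x∈) with simplicial-exists chordal diamond-free x∈
    ...   | v , simplicial = extend-model diamond-free simplicial
              (build fuel (S - v) (ℕ.s≤s⁻¹ (ℕₚ.<-≤-trans (x∈p⇒∣p-x∣<∣p∣ (proj₁ simplicial)) |S|≤)))

  module Coordinates (M : BlockModel ⊤) where
    open BlockModel M

    N : ℕ
    N = n G + blocks

    element : Fin N → V ⊎ Fin blocks
    element = splitAt (n G)

    keysOf : V ⊎ Fin blocks → Keys
    keysOf (inj₁ w) = vertexKeys (position w) (level w)
    keysOf (inj₂ B) = blockKeys (position (anchor B)) (stamp B)

    module X = Rank <ₖ-trans <ₖ-cmp (Keys.x ∘ keysOf ∘ element)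
    module Y = Rank (Flip.trans _<_ ℕₚ.<-trans) (Flip.compare _<_ ℕₚ.<-cmp) (Keys.y ∘ keysOf ∘ element)
    module Z = Rank (Flip.trans _<ₖ_ <ₖ-trans) (Flip.compare _<ₖ_ <ₖ-cmp) (Keys.z ∘ keysOf ∘ element)

    coordinates : Fin N → Point 3
    coordinates e = ℕ→ℚ (X.rank e) ∷ ℕ→ℚ (Y.rank e) ∷ ℕ→ℚ (Z.rank e) ∷ []

    ≺⇒⋖ : ∀ a b → coordinates a ≺ coordinates b → keysOf (element a) ⋖ keysOf (element b)
    ≺⇒⋖ a b a≺b = X.rank-cancel-< a b (ℕ→ℚ-cancel-< (a≺b zero))
                , Y.rank-cancel-< a b (ℕ→ℚ-cancel-< (a≺b (suc zero)))
                , Z.rank-cancel-< a b (ℕ→ℚ-cancel-< (a≺b (suc (suc zero))))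

    ⋖⇒≺ : ∀ a b → keysOf (element a) ⋖ keysOf (element b) → coordinates a ≺ coordinates b
    ⋖⇒≺ a b (x , y , z) zero             = ℕ→ℚ-mono-< (X.rank-mono-< a b x)
    ⋖⇒≺ a b (x , y , z) (suc zero)       = ℕ→ℚ-mono-< (Y.rank-mono-< a b y)
    ⋖⇒≺ a b (x , y , z) (suc (suc zero)) = ℕ→ℚ-mono-< (Z.rank-mono-< a b z)

    element-injective : ∀ {a b} → element a ≡ element b → a ≡ b
    element-injective {a} {b} eq = trans (sym (Finₚ.join-splitAt (n G) blocks a))
                                         (trans (cong (Fin.join (n G) blocks) eq) (Finₚ.join-splitAt (n G) blocks b))

    keys-injective : ∀ u w → Keys.x (keysOf u) ≡ Keys.x (keysOf w) → Keys.y (keysOf u) ≡ Keys.y (keysOf w) → u ≡ w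
    keys-injective (inj₁ x) (inj₁ y) x≡ _ = cong inj₁ (position-injective ∈⊤ ∈⊤ (cong proj₁ x≡))
    keys-injective (inj₁ _) (inj₂ _) x≡ _ with cong proj₂ x≡
    ... | ()
    keys-injective (inj₂ _) (inj₁ _) x≡ _ with cong proj₂ x≡
    ... | ()
    keys-injective (inj₂ B) (inj₂ B′) _ y≡ =
      cong inj₂ (stamp-injective
        (ℕₚ.*-cancelˡ-≡ (stamp B) (stamp B′) 4 (ℕₚ.+-cancelʳ-≡ 2 (4 * stamp B) (4 * stamp B′) y≡)))

    coordinates-injective : Injective coordinates
    coordinates-injective a b eq = element-injective (keys-injective (element a) (element b)
      (X.rank-injective a b (ℕ→ℚ-injective (cong (λ q → lookup q zero) eq)))
      (Y.rank-injective a b (ℕ→ℚ-injective (cong (λ q → lookup q (suc zero)) eq))))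

    block-not-⋖-block : ∀ B B′ → ¬ keysOf (inj₂ B) ⋖ keysOf (inj₂ B′)
    block-not-⋖-block B B′ B⋖B′ with two-members B′
    ... | c , d , c≢d , c∈B′ , d∈B′ with block-unique c≢d (in-B c∈B′) (in-B d∈B′) c∈B′ d∈B′
      where
      in-B : ∀ {w} → w ∈ᵇ B′ → w ∈ᵇ B
      in-B (w∈ , B′⋖w) = w∈ , ⋖-trans B⋖B′ B′⋖w
    ...   | refl = ⋖-irrefl B⋖B′

    nothing-⋖-block : ∀ u B → ¬ keysOf u ⋖ keysOf (inj₂ B)
    nothing-⋖-block (inj₁ w) B = vertex-not-⋖-block (position w) (level w) (position (anchor B)) (stamp B)
    nothing-⋖-block (inj₂ B′) B = block-not-⋖-block B′ B

    vertex-not-⋖ : ∀ w u → ¬ keysOf (inj₁ w) ⋖ keysOf u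
    vertex-not-⋖ w (inj₁ w′) = vertex-not-⋖-vertex (position w) (level w) (position w′) (level w′)
    vertex-not-⋖ w (inj₂ B)  = nothing-⋖-block (inj₁ w) B

    isolated-adjacency⇒ : ∀ a b → PlusIsolatedAdj G blocks a b →
      Σ V λ x → Σ V λ y → element a ≡ inj₁ x × element b ≡ inj₁ y × x ~ y
    isolated-adjacency⇒ a b adj with splitAt (n G) a | splitAt (n G) b
    ... | inj₁ x | inj₁ y = x , y , refl , refl , adj

    competition : ∀ a b → a ≢ b → (PlusIsolatedAdj G blocks a b → CompAdj coordinates a b)
                                 × (CompAdj coordinates a b → PlusIsolatedAdj G blocks a b)
    competition a b a≢b = adjacent⇒compete , compete⇒adjacent
      where
      adjacent⇒compete : PlusIsolatedAdj G blocks a b → CompAdj coordinates a b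
      adjacent⇒compete adj with isolated-adjacency⇒ a b adj
      ... | x , y , a≡x , b≡y , x~y with edge⇒block ∈⊤ ∈⊤ (~⇒≢ x~y) x~y
      ...   | B , (_ , B⋖x) , (_ , B⋖y) = n G Fin.↑ʳ B , below a≡x B⋖x , below b≡y B⋖y
        where
        below : ∀ {d w} → element d ≡ inj₁ w → keysOf (inj₂ B) ⋖ keysOf (inj₁ w) →
                coordinates (n G Fin.↑ʳ B) ≺ coordinates d
        below {d} d≡ B⋖w =
          ⋖⇒≺ _ d (subst₂ (λ u w → keysOf u ⋖ keysOf w) (sym (Finₚ.splitAt-↑ʳ (n G) blocks B)) (sym d≡) B⋖w)

      compete⇒adjacent : CompAdj coordinates a b → PlusIsolatedAdj G blocks a b
      compete⇒adjacent (c , c≺a , c≺b) with ≺⇒⋖ c a c≺a | ≺⇒⋖ c b c≺b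
      ... | c⋖a | c⋖b with element c | element a in a≡ | element b in b≡
      ... | inj₁ w | u     | _     = ⊥-elim (vertex-not-⋖ w u c⋖a)
      ... | inj₂ B | inj₂ B′ | _    = ⊥-elim (nothing-⋖-block (inj₂ B) B′ c⋖a)
      ... | inj₂ B | inj₁ _ | inj₂ B′ = ⊥-elim (nothing-⋖-block (inj₂ B) B′ c⋖b)
      ... | inj₂ B | inj₁ x | inj₁ y =
        block⇒edge (λ { refl → a≢b (element-injective (trans a≡ (sym b≡))) }) (∈⊤ , c⋖a) (∈⊤ , c⋖b)

    representation : PocRepresentation G 3
    representation = blocks , coordinates , coordinates-injective , competition

mainTheorem1 : (G : Graph) → Chordal G → DiamondFree G → DimPocAtMost G 3
mainTheorem1 G chordal diamond-free =
  3 , ℕₚ.≤-refl , Coordinates.representation G (block-model G chordal diamond-free ⊤)
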